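{- For $n\in\mathbb{N}$ let $v_1,\dots,v_n$ be distinct variables, $C_1:=\{v_1,\dots,v_n\}$, $C_2:=\{v_1,\dots,v_{n-1},\overline{v_n}\}$ (XOR-clauses), and $T_n:=X_1(\{C_1,C_2\})$, where both clauses are split in the order $v_1,\dots,v_n$ with disjoint auxiliary variables. Then: (1) $n(T_n)=3n-4$ for $n\ge2$; (2) $c(T_n)=8n-12$ for $n\ge2$; (3) $\ell(T_n)=24n-40$ for $n\ge2$; (4) $T_n$ is unsatisfiable and all its clauses have length at most $3$; (5) for $n\ge3$, $\mathrm{whd}(T_n)=\mathrm{wid}(T_n)=3$; (6) for $n\ge2$ there exists a resolution refutation of $T_n$ consisting of $18n-29$ clauses in total (axioms included).
   Context: Clauses are finite sets of literals without complementary pairs ($\bot$ empty clause), clause-sets finite sets of clauses read as CNF; $n(F)=|\mathrm{var}(F)|$, $c(F)=|F|$, $\ell(F)=\sum_{C\in F}|C|$. An XOR-clause $C$ denotes $\bigoplus_{x\in C}x=0$ over $\mathbb{Z}_2$. $X_0(C)$: all clauses $D$ with $\mathrm{var}(D)=\mathrm{var}(C)$ whose number of complemented literals has parity different from that of $C$. Natural splitting of $C=\{x_1,\dots,x_m\}$ in the given order: $\{C\}$ if $m\le2$, else the XOR-clauses $\{x_1,x_2,y_2\}$, $\{y_{i-1},x_i,y_i\}$ ($3\le i\le m-1$), $\{y_{m-1},x_m\}$ with new variables $y_2,\dots,y_{m-1}$; $X_1(C)$ is the union of $X_0$ of these, and $X_1$ of a set is the union. Two clauses resolve if they clash in exactly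 one literal $x$ ($x\in C$, $\overline x\in D$), the resolvent being $(C\cup D)\setminus\{x,\overline x\}$. For unsatisfiable $F$: $\mathrm{whd}(F)$ is the least $k$ such that $\bot$ is derivable from $F$ by resolution where in each step at least one parent has length $\le k$; $\mathrm{wid}(F)$ is the least $k$ such that $\bot$ is derivable with all clauses (axioms and resolvents) of length $\le k$. -}

module Defs where

open import Data.Nat using (ℕ; zero; suc; _+_; _∸_; _≤_; _<_)
open import Data.Nat using () renaming (_≡ᵇ_ to _≡ℕᵇ_)
open import Data.Bool using (Bool; true; false; if_then_else_; _∧_; _∨_; _xor_; not)
open import Data.List using (List; []; _∷_; [_]; _++_; map; concatMap; filterᵇ; length; upTo)
open import Data.Bool.ListAction using (any; all)
open import Data.Nat.ListAction using (sum)
open import Data.List.Membership.Propositional using (_∈_)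
open import Data.List.Relation.Unary.All using (All)
open import Data.List.Relation.Unary.Any using (Any)
open import Data.List.Relation.Unary.AllPairs using (AllPairs)
open import Data.Product using (_×_; Σ)
open import Data.Sum using (_⊎_)
open import Relation.Binary.PropositionalEquality using (_≡_; _≢_)
open import Relation.Nullary using (¬_)

-- Variables: the original variables v i, and auxiliary variables
-- y j i  (the i-th new variable introduced when splitting clause number j).
data Var : Set where
  v : ℕ → Var
  y : ℕ → ℕ → Var

data Lit : Set where
  pos : Var → Lit
  neg : Var → Lit

var : Lit → Var
var (pos x) = x
var (neg x) = x

compl : Lit → Lit
compl (pos x) = neg x
compl (neg x) = pos x

isNeg : Lit → Bool
isNeg (pos _) = false
isNeg (neg _) = true

-- Clauses are finite sets of literals, represented by lists; every
-- notion below only depends on the underlying set (membership).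
Clause : Set
Clause = List Lit

ClauseSet : Set
ClauseSet = List Clause

_==V_ : Var → Var → Bool
v i ==V v j = i ≡ℕᵇ j
v _ ==V y _ _ = false
y _ _ ==V v _ = false
y a i ==V y b j = (a ≡ℕᵇ b) ∧ (i ≡ℕᵇ j)

_==L_ : Lit → Lit → Bool
pos x ==L pos x' = x ==V x'
neg x ==L neg x' = x ==V x'
pos _ ==L neg _ = false
neg _ ==L pos _ = false

_==C_ : Clause → Clause → Bool
C ==C D = all (λ l → any (l ==L_) D) C ∧ all (λ l → any (l ==L_) C) D

nub : {A : Set} → (A → A → Bool) → List A → List A
nub eq [] = []
nub eq (x ∷ xs) = if any (eq x) xs then nub eq xs else x ∷ nub eq xs

size : Clause → ℕ
size C = length (nub _==L_ C)

nVars : ClauseSet → ℕ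
nVars F = length (nub _==V_ (concatMap (map var) F))

cClauses : ClauseSet → ℕ
cClauses F = length (nub _==C_ F)

ℓLits : ClauseSet → ℕ
ℓLits F = sum (map size (nub _==C_ F))

evalL : (Var → Bool) → Lit → Bool
evalL α (pos x) = α x
evalL α (neg x) = not (α x)

SatC : (Var → Bool) → Clause → Set
SatC α C = Any (λ l → evalL α l ≡ true) C

Unsat : ClauseSet → Set
Unsat F = (α : Var → Bool) → ¬ All (SatC α) F

parity : ℕ → Bool
parity zero = false
parity (suc k) = not (parity k)

negCount : Clause → ℕ
negCount C = length (filterᵇ isNeg C)

allSigns : List Var → List Clause
allSigns [] = [ [] ]
allSigns (x ∷ xs) = map (pos x ∷_) (allSigns xs) ++ map (neg x ∷_) (allSigns xs)

X₀ : Clause → ClauseSet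
X₀ C = filterᵇ (λ D → parity (negCount D) xor parity (negCount C)) (allSigns (map var C))

-- natural splitting of C = (x₁,…,xₘ) using new variables aux 2,…,aux (m-1)
splitChain : (ℕ → Var) → ℕ → Lit → List Lit → List Clause
splitChain aux i p [] = []
splitChain aux i p (x ∷ []) = [ p ∷ x ∷ [] ]
splitChain aux i p (x ∷ x' ∷ xs) =
  (p ∷ x ∷ pos (aux i) ∷ []) ∷ splitChain aux (suc i) (pos (aux i)) (x' ∷ xs)

natSplit : (ℕ → Var) → List Lit → List Clause
natSplit aux (x₁ ∷ x₂ ∷ x₃ ∷ xs) =
  (x₁ ∷ x₂ ∷ pos (aux 2) ∷ []) ∷ splitChain aux 3 (pos (aux 2)) (x₃ ∷ xs)
natSplit aux C = [ C ]

X₁ : (ℕ → Var) → Clause → ClauseSet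
X₁ aux C = concatMap X₀ (natSplit aux C)

C₁ : ℕ → Clause
C₁ n = map (λ i → pos (v (suc i))) (upTo n)

-- C₂ = {v₁,…,v_{n-1}, ¬vₙ}   (meaningful for n ≥ 1)
C₂ : ℕ → Clause
C₂ n = map (λ i → pos (v (suc i))) (upTo (n ∸ 1)) ++ [ neg (v n) ]

T : ℕ → ClauseSet
T n = X₁ (y 1) (C₁ n) ++ X₁ (y 2) (C₂ n)

SetEq : Clause → Clause → Set
SetEq C D = (z : Lit) → (z ∈ C → z ∈ D) × (z ∈ D → z ∈ C)

record Resolves (C D R : Clause) : Set where
  field
    lit     : Lit
    inC     : lit ∈ C
    inD     : compl lit ∈ D
    unique  : (z : Lit) → z ∈ C → compl z ∈ D → z ≡ lit
    resolvent : (z : Lit) →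
      (z ∈ R → (z ∈ C ⊎ z ∈ D) × z ≢ lit × z ≢ compl lit) ×
      ((z ∈ C ⊎ z ∈ D) × z ≢ lit × z ≢ compl lit → z ∈ R)

data WhdDeriv (k : ℕ) (F : ClauseSet) : Clause → Set where
  axiom : {C : Clause} → C ∈ F → WhdDeriv k F C
  resolve : {C D R : Clause} → WhdDeriv k F C → WhdDeriv k F D →
            Resolves C D R → (size C ≤ k ⊎ size D ≤ k) → WhdDeriv k F R

data WidDeriv (k : ℕ) (F : ClauseSet) : Clause → Set where
  axiom : {C : Clause} → C ∈ F → size C ≤ k → WidDeriv k F C
  resolve : {C D R : Clause} → WidDeriv k F C → WidDeriv k F D →
            Resolves C D R → size R ≤ k → WidDeriv k F R

IsWhd : ClauseSet → ℕ → Set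
IsWhd F k = WhdDeriv k F [] × ((j : ℕ) → j < k → ¬ WhdDeriv j F [])

IsWid : ClauseSet → ℕ → Set
IsWid F k = WidDeriv k F [] × ((j : ℕ) → j < k → ¬ WidDeriv j F [])

-- resolution sequences, most recent clause first: each clause is an
-- axiom of F or a resolvent of two earlier clauses
data ResSeq (F : ClauseSet) : List Clause → Set where
  []      : ResSeq F []
  axiom   : {L : List Clause} {C : Clause} → ResSeq F L → C ∈ F → ResSeq F (C ∷ L)
  resolve : {L : List Clause} {C D R : Clause} → ResSeq F L →
            C ∈ L → D ∈ L → Resolves C D R → ResSeq F (R ∷ L)

RefutationOfSize : ClauseSet → ℕ → Set
RefutationOfSize F m =
  Σ (List Clause) λ L →
    ResSeq F ([] ∷ L) × AllPairs (λ C D → ¬ SetEq C D) ([] ∷ L) × length ([] ∷ L) ≡ m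

-- After general facts on literals, duplicate removal (nub), renaming by
-- index shifts, and checking concrete resolution steps by computation, we
-- bring T (3 + k) into the normal form T′ k: the union of X₀ over the blocks
--   first a,  shiftC j (middle a) (j < k),  shiftC k (last a ±v₃)
-- of the two chains a = 1, 2; every block is a shift of one of six templates.
-- All claims about T′ k then reduce to finite computations on templates plus
-- invariance under shifting:
--  * unsatisfiability: a model forces y¹ᵢ = y²ᵢ along the chains, which the
--    last blocks contradict;
--  * whd ≥ 3: (LayerInvariant) clauses that are binary on the last layer or
--    wide are closed under resolution with a parent of size ≤ 2, and ⊥ is
--    neither;
--  * wid ≤ 3 and the size 18n − 29: an explicit refutation glued from three
--    shifted template fragments, its clauses told apart by index keys;
--  * n, c, ℓ: the clauses of T′ k are pairwise different, so c and ℓ are sums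
--    over the blocks; the variables are enumerated explicitly.
module Submission where

open import Defs
open import Data.Nat using (ℕ; zero; suc; _+_; _*_; _∸_; _≤_; _<_; z≤n; s≤s; _≟_; _≤?_; _≡ᵇ_)
open import Data.Nat.Properties
  using ( +-commutativeSemigroup; ≡ᵇ⇒≡; ≡⇒≡ᵇ; +-identityʳ; +-suc; +-cancelʳ-≡; +-cancelˡ-≡; +-monoˡ-≤; +-monoʳ-≤
        ; +-mono-≤; *-comm; *-distribˡ-+; m+n∸m≡n; suc-injective; 1+n≢n; <⇒≢; <⇒≱; ≤-trans; ≤-refl
        ; ≤-antisym; ≤-reflexive; n≤1+n; m<1+n⇒m<n∨m≡n)
open import Data.Nat.ListAction using (sum)
open import Data.Nat.ListAction.Properties using (sum-++)
open import Data.Nat.Tactic.RingSolver using (solve-∀)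
open import Algebra.Properties.CommutativeSemigroup +-commutativeSemigroup using (interchange)
open import Data.Bool using (Bool; true; false; _xor_; not) renaming (T to Tᵇ)
open import Data.Bool.Properties using (T-∧)
open import Data.Bool.ListAction using (any; all)
open import Data.List using (List; []; _∷_; [_]; _++_; map; length; concatMap; applyUpTo)
open import Data.List.Properties
  using (≡-dec; map-++; length-++; length-map; map-upTo; applyUpTo-∷ʳ; length-applyUpTo; concatMap-++)
open import Data.List.Membership.Propositional using (_∈_; find)
open import Data.List.Membership.Propositional.Properties
  using (∈-map⁺; ∈-map⁻; ∈-++⁺ˡ; ∈-++⁺ʳ; ∈-++⁻; ∈-∃++; ∈-concatMap⁺; ∈-concatMap⁻; ∈-applyUpTo⁺; ∈-applyUpTo⁻)
import Data.List.Membership.DecPropositional as DecMembership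
open import Data.List.Relation.Unary.All as All using (All; []; _∷_)
import Data.List.Relation.Unary.All.Properties as All
open import Data.List.Relation.Unary.Any as Any using (Any; here; there)
import Data.List.Relation.Unary.Any.Properties as Any
open import Data.List.Relation.Unary.AllPairs as AllPairs using (AllPairs; []; _∷_)
import Data.List.Relation.Unary.AllPairs.Properties as AllPairs
open import Data.List.Relation.Unary.Unique.Propositional using (Unique)
import Data.List.Relation.Unary.Unique.Propositional.Properties as Unique
open import Data.Product using (_×_; Σ; _,_; proj₁; proj₂)
open import Data.Sum as Sum using (_⊎_; inj₁; inj₂; swap)
open import Data.Empty using (⊥; ⊥-elim)
open import Function using (_∘_)
open import Function.Bundles using (Equivalence)
open import Relation.Binary using (DecidableEquality)
open import Relation.Binary.PropositionalEquality
  using (_≡_; _≢_; refl; sym; trans; cong; cong₂; subst; module ≡-Reasoning)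
open import Relation.Nullary using (¬_; Dec; yes; no)
open import Relation.Nullary.Decidable using (_×-dec_; _⊎-dec_; _→-dec_; ¬?; toWitness; True)

_≟V_ : DecidableEquality Var
v i ≟V v j with i ≟ j
... | yes refl = yes refl
... | no i≢j = no λ { refl → i≢j refl }
v _ ≟V y _ _ = no λ ()
y _ _ ≟V v _ = no λ ()
y a i ≟V y b j with a ≟ b | i ≟ j
... | yes refl | yes refl = yes refl
... | no a≢b | _ = no λ { refl → a≢b refl }
... | yes _ | no i≢j = no λ { refl → i≢j refl }

_≟L_ : DecidableEquality Lit
pos x ≟L pos x' with x ≟V x'
... | yes refl = yes refl
... | no x≢x' = no λ { refl → x≢x' refl }
neg x ≟L neg x' with x ≟V x'
... | yes refl = yes refl
... | no x≢x' = no λ { refl → x≢x' refl }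
pos _ ≟L neg _ = no λ ()
neg _ ≟L pos _ = no λ ()

==V-sound : ∀ x x' → Tᵇ (x ==V x') → x ≡ x'
==V-sound (v i) (v j) t = cong v (≡ᵇ⇒≡ i j t)
==V-sound (y a i) (y b j) t with Equivalence.to T-∧ t
... | ta , ti rewrite ≡ᵇ⇒≡ a b ta | ≡ᵇ⇒≡ i j ti = refl

==V-refl : ∀ x → Tᵇ (x ==V x)
==V-refl (v i) = ≡⇒≡ᵇ i i refl
==V-refl (y a i) = Equivalence.from T-∧ (≡⇒≡ᵇ a a refl , ≡⇒≡ᵇ i i refl)

==L-sound : ∀ l l' → Tᵇ (l ==L l') → l ≡ l'
==L-sound (pos x) (pos x') t = cong pos (==V-sound x x' t)
==L-sound (neg x) (neg x') t = cong neg (==V-sound x x' t)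

==L-refl : ∀ l → Tᵇ (l ==L l)
==L-refl (pos x) = ==V-refl x
==L-refl (neg x) = ==V-refl x

compl-involutive : ∀ l → compl (compl l) ≡ l
compl-involutive (pos x) = refl
compl-involutive (neg x) = refl

var-compl : ∀ l → var (compl l) ≡ var l
var-compl (pos x) = refl
var-compl (neg x) = refl

l≢compl : ∀ l → l ≢ compl l
l≢compl (pos x) ()
l≢compl (neg x) ()

v-injective : ∀ {i i'} → v i ≡ v i' → i ≡ i'
v-injective refl = refl

y-injective : ∀ {a b i i'} → y a i ≡ y b i' → a ≡ b × i ≡ i'
y-injective refl = refl , refl

sameVar⇒≡⊎compl : ∀ l l' → var l ≡ var l' → l ≡ l' ⊎ l ≡ compl l'
sameVar⇒≡⊎compl (pos x) (pos .x) refl = inj₁ refl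
sameVar⇒≡⊎compl (pos x) (neg .x) refl = inj₂ refl
sameVar⇒≡⊎compl (neg x) (pos .x) refl = inj₂ refl
sameVar⇒≡⊎compl (neg x) (neg .x) refl = inj₁ refl

module _ {A : Set} (eq : A → A → Bool) where

  nub-⊆ : ∀ {xs z} → z ∈ nub eq xs → z ∈ xs
  nub-⊆ {x ∷ xs} m with any (eq x) xs
  ... | true = there (nub-⊆ m)
  nub-⊆ {x ∷ xs} (here refl) | false = here refl
  nub-⊆ {x ∷ xs} (there m) | false = there (nub-⊆ m)

  nub-⊇ : (∀ a b → Tᵇ (eq a b) → a ≡ b) → ∀ {xs z} → z ∈ xs → z ∈ nub eq xs
  nub-⊇ sound {x ∷ xs} m with any (eq x) xs in e
  nub-⊇ sound {x ∷ xs} (here refl) | true =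
    nub-⊇ sound (Any.map (sound x _) (Any.any⁻ (eq x) xs (subst Tᵇ (sym e) _)))
  nub-⊇ sound {x ∷ xs} (there m) | true = nub-⊇ sound m
  nub-⊇ sound {x ∷ xs} (here refl) | false = here refl
  nub-⊇ sound {x ∷ xs} (there m) | false = there (nub-⊇ sound m)

  nub-unique : (∀ a → Tᵇ (eq a a)) → ∀ xs → Unique (nub eq xs)
  nub-unique eq-refl [] = []
  nub-unique eq-refl (x ∷ xs) with any (eq x) xs in e
  ... | true = nub-unique eq-refl xs
  ... | false = All.tabulate fresh ∷ nub-unique eq-refl xs
    where
    fresh : ∀ {w} → w ∈ nub eq xs → x ≢ w
    fresh m refl = subst Tᵇ e (Any.any⁺ (eq x) (Any.map (λ { refl → eq-refl x }) (nub-⊆ {xs} m)))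

  length-nub≤ : ∀ xs → length (nub eq xs) ≤ length xs
  length-nub≤ [] = z≤n
  length-nub≤ (x ∷ xs) with any (eq x) xs
  ... | true = ≤-trans (length-nub≤ xs) (n≤1+n _)
  ... | false = s≤s (length-nub≤ xs)

  any-false : ∀ {x ws} → All (λ w → eq x w ≡ false) ws → any (eq x) ws ≡ false
  any-false [] = refl
  any-false (e ∷ es) rewrite e = any-false es

  nub-distinct : ∀ xs → AllPairs (λ a b → eq a b ≡ false) xs → nub eq xs ≡ xs
  nub-distinct [] _ = refl
  nub-distinct (x ∷ xs) (x≠xs ∷ xs≠) rewrite any-false x≠xs = cong (x ∷_) (nub-distinct xs xs≠)

unique-length≤ : ∀ {A : Set} {xs ys : List A} → Unique xs → (∀ {z} → z ∈ xs → z ∈ ys) → length xs ≤ length ys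
unique-length≤ {xs = []} _ _ = z≤n
unique-length≤ {xs = x ∷ xs} {ys} (x∉xs ∷ u) xs⊆ys with ∈-∃++ (xs⊆ys (here refl))
... | us , ws , refl = subst (suc (length xs) ≤_) (sym length-split) (s≤s (unique-length≤ u xs⊆us++ws))
  where
  length-split : length (us ++ [ x ] ++ ws) ≡ suc (length (us ++ ws))
  length-split = trans (length-++ us) (trans (+-suc (length us) (length ws)) (cong suc (sym (length-++ us))))
  xs⊆us++ws : ∀ {z} → z ∈ xs → z ∈ us ++ ws
  xs⊆us++ws m with ∈-++⁻ us (xs⊆ys (there m))
  ... | inj₁ mu = ∈-++⁺ˡ mu
  ... | inj₂ (here refl) = ⊥-elim (All.lookup x∉xs m refl)
  ... | inj₂ (there mw) = ∈-++⁺ʳ us mw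

length-nub : ∀ {A : Set} (eq : A → A → Bool) → (∀ a b → Tᵇ (eq a b) → a ≡ b) → (∀ a → Tᵇ (eq a a)) →
  ∀ xs {ys} → Unique ys → (∀ {z} → z ∈ xs → z ∈ ys) → (∀ {z} → z ∈ ys → z ∈ xs) → length (nub eq xs) ≡ length ys
length-nub eq sound eq-refl xs uys xs⊆ys ys⊆xs =
  ≤-antisym (unique-length≤ (nub-unique eq eq-refl xs) (xs⊆ys ∘ nub-⊆ eq))
            (unique-length≤ uys (nub-⊇ eq sound ∘ ys⊆xs))

size≤length : ∀ C → size C ≤ length C
size≤length C = length-nub≤ _==L_ C

three-literals⇒3≤size : ∀ {C a b c} → a ∈ C → b ∈ C → c ∈ C → a ≢ b → a ≢ c → b ≢ c → 3 ≤ size C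
three-literals⇒3≤size {C} {a} {b} {c} ma mb mc a≢b a≢c b≢c =
  unique-length≤ {xs = a ∷ b ∷ c ∷ []} ((a≢b ∷ a≢c ∷ []) ∷ (b≢c ∷ []) ∷ [] ∷ [])
    λ { (here refl) → nub-⊇ _==L_ ==L-sound ma
      ; (there (here refl)) → nub-⊇ _==L_ ==L-sound mb
      ; (there (there (here refl))) → nub-⊇ _==L_ ==L-sound mc }

-- All blocks of
-- T (3 + k) are shifts of a few fixed templates, and every notion involved
-- (resolution, set equality, size) is invariant under this injective renaming.
shiftV : ℕ → Var → Var
shiftV j (v i) = v (i + j)
shiftV j (y a i) = y a (i + j)

shiftL : ℕ → Lit → Lit
shiftL j (pos x) = pos (shiftV j x)
shiftL j (neg x) = neg (shiftV j x)

shiftC : ℕ → Clause → Clause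
shiftC j = map (shiftL j)

shiftV-injective : ∀ j {x x'} → shiftV j x ≡ shiftV j x' → x ≡ x'
shiftV-injective j {v i} {v i'} e = cong v (+-cancelʳ-≡ j i i' (v-injective e))
shiftV-injective j {y a i} {y b i'} e with y-injective e
... | refl , e' = cong (y a) (+-cancelʳ-≡ j i i' e')

shiftL-injective : ∀ j {l l'} → shiftL j l ≡ shiftL j l' → l ≡ l'
shiftL-injective j {pos x} {pos x'} e = cong pos (shiftV-injective j (cong var e))
shiftL-injective j {neg x} {neg x'} e = cong neg (shiftV-injective j (cong var e))
shiftL-injective j {pos x} {neg x'} ()
shiftL-injective j {neg x} {pos x'} ()

compl-shift : ∀ j l → compl (shiftL j l) ≡ shiftL j (compl l)
compl-shift j (pos x) = refl
compl-shift j (neg x) = refl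

∈-shift⁺ : ∀ j {z C} → z ∈ C → shiftL j z ∈ shiftC j C
∈-shift⁺ j = ∈-map⁺ (shiftL j)

∈-shift⁻ : ∀ j {z C} → shiftL j z ∈ shiftC j C → z ∈ C
∈-shift⁻ j m with ∈-map⁻ (shiftL j) m
... | w , mw , e rewrite shiftL-injective j e = mw

SetEq-unshift : ∀ j {C D} → SetEq (shiftC j C) (shiftC j D) → SetEq C D
SetEq-unshift j s z = (λ m → ∈-shift⁻ j (proj₁ (s (shiftL j z)) (∈-shift⁺ j m))) ,
                      (λ m → ∈-shift⁻ j (proj₂ (s (shiftL j z)) (∈-shift⁺ j m)))

Resolves-shift : ∀ j {C D R} → Resolves C D R → Resolves (shiftC j C) (shiftC j D) (shiftC j R)
Resolves-shift j {C} {D} {R} r = record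
  { lit = shiftL j l
  ; inC = ∈-shift⁺ j (Resolves.inC r)
  ; inD = subst (_∈ shiftC j D) (sym (compl-shift j l)) (∈-shift⁺ j (Resolves.inD r))
  ; unique = unique
  ; resolvent = λ z → resolvent⁻ z , resolvent⁺ z }
  where
  l : Lit
  l = Resolves.lit r
  avoid⁻ : ∀ z → z ≢ l × z ≢ compl l → shiftL j z ≢ shiftL j l × shiftL j z ≢ compl (shiftL j l)
  avoid⁻ z (n₁ , n₂) = (λ e → n₁ (shiftL-injective j e)) ,
                       (λ e → n₂ (shiftL-injective j (trans e (compl-shift j l))))
  avoid⁺ : ∀ z → shiftL j z ≢ shiftL j l × shiftL j z ≢ compl (shiftL j l) → z ≢ l × z ≢ compl l
  avoid⁺ z (n₁ , n₂) = (λ e → n₁ (cong (shiftL j) e)) ,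
                       (λ e → n₂ (trans (cong (shiftL j) e) (sym (compl-shift j l))))
  sides⁺ : ∀ {z} → z ∈ C ⊎ z ∈ D → shiftL j z ∈ shiftC j C ⊎ shiftL j z ∈ shiftC j D
  sides⁺ (inj₁ m) = inj₁ (∈-shift⁺ j m)
  sides⁺ (inj₂ m) = inj₂ (∈-shift⁺ j m)
  sides⁻ : ∀ {z} → shiftL j z ∈ shiftC j C ⊎ shiftL j z ∈ shiftC j D → z ∈ C ⊎ z ∈ D
  sides⁻ (inj₁ m) = inj₁ (∈-shift⁻ j m)
  sides⁻ (inj₂ m) = inj₂ (∈-shift⁻ j m)
  unique : ∀ z → z ∈ shiftC j C → compl z ∈ shiftC j D → z ≡ shiftL j l
  unique z mz mcz with ∈-map⁻ (shiftL j) mz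
  ... | z₀ , mz₀ , refl = cong (shiftL j) (Resolves.unique r z₀ mz₀
          (∈-shift⁻ j (subst (_∈ shiftC j D) (compl-shift j z₀) mcz)))
  resolvent⁻ : ∀ z → z ∈ shiftC j R →
    (z ∈ shiftC j C ⊎ z ∈ shiftC j D) × z ≢ shiftL j l × z ≢ compl (shiftL j l)
  resolvent⁻ z mz with ∈-map⁻ (shiftL j) mz
  ... | z₀ , mz₀ , refl with proj₁ (Resolves.resolvent r z₀) mz₀
  ... | side , avoids = sides⁺ side , avoid⁻ z₀ avoids
  resolvent⁺ : ∀ z → (z ∈ shiftC j C ⊎ z ∈ shiftC j D) × z ≢ shiftL j l × z ≢ compl (shiftL j l) →
    z ∈ shiftC j R
  resolvent⁺ z (inj₁ m , avoids) with ∈-map⁻ (shiftL j) m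
  ... | z₀ , _ , refl = ∈-shift⁺ j (proj₂ (Resolves.resolvent r z₀) (sides⁻ (inj₁ m) , avoid⁺ z₀ avoids))
  resolvent⁺ z (inj₂ m , avoids) with ∈-map⁻ (shiftL j) m
  ... | z₀ , _ , refl = ∈-shift⁺ j (proj₂ (Resolves.resolvent r z₀) (sides⁻ (inj₂ m) , avoid⁺ z₀ avoids))

Resolves-sym : ∀ {C D R} → Resolves C D R → Resolves D C R
Resolves-sym {C} {D} {R} r = record
  { lit = compl l
  ; inC = Resolves.inD r
  ; inD = subst (_∈ C) (sym (compl-involutive l)) (Resolves.inC r)
  ; unique = λ z mz mcz → trans (sym (compl-involutive z))
      (cong compl (Resolves.unique r (compl z) mcz (subst (_∈ D) (sym (compl-involutive z)) mz)))
  ; resolvent = λ z → resolvent⁻ z , resolvent⁺ z }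
  where
  l : Lit
  l = Resolves.lit r
  resolvent⁻ : ∀ z → z ∈ R → (z ∈ D ⊎ z ∈ C) × z ≢ compl l × z ≢ compl (compl l)
  resolvent⁻ z m with proj₁ (Resolves.resolvent r z) m
  ... | side , n₁ , n₂ = swap side , n₂ , (λ e → n₁ (trans e (compl-involutive l)))
  resolvent⁺ : ∀ z → (z ∈ D ⊎ z ∈ C) × z ≢ compl l × z ≢ compl (compl l) → z ∈ R
  resolvent⁺ z (side , n₁ , n₂) =
    proj₂ (Resolves.resolvent r z) (swap side , (λ e → n₂ (trans e (sym (compl-involutive l)))) , n₁)

-- Shifting preserves the size of a clause (nub commutes with injective maps).
size-shift : ∀ j C → size (shiftC j C) ≡ size C
size-shift j C = trans
  (length-nub _==L_ ==L-sound ==L-refl (shiftC j C)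
     (Unique.map⁺ (shiftL-injective j) (nub-unique _==L_ ==L-refl C)) to from)
  (length-map (shiftL j) (nub _==L_ C))
  where
  to : ∀ {z} → z ∈ shiftC j C → z ∈ shiftC j (nub _==L_ C)
  to m with ∈-map⁻ (shiftL j) m
  ... | z₀ , mz₀ , refl = ∈-shift⁺ j (nub-⊇ _==L_ ==L-sound mz₀)
  from : ∀ {z} → z ∈ shiftC j (nub _==L_ C) → z ∈ shiftC j C
  from m with ∈-map⁻ (shiftL j) m
  ... | z₀ , mz₀ , refl = ∈-shift⁺ j (nub-⊆ _==L_ {C} mz₀)

_∈?_ : (l : Lit) (C : Clause) → Dec (l ∈ C)
l ∈? C = DecMembership._∈?_ _≟L_ l C

_∈?ᶜ_ : (C : Clause) (Cs : List Clause) → Dec (C ∈ Cs)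
C ∈?ᶜ Cs = DecMembership._∈?_ (≡-dec _≟L_) C Cs

ResolutionStep : Clause → Clause → Clause → Lit → Set
ResolutionStep C D R l = (l ∈ C) × (compl l ∈ D) × All (λ z → compl z ∈ D → z ≡ l) C
  × All (λ z → (z ∈ C ⊎ z ∈ D) × z ≢ l × z ≢ compl l) R
  × All (λ z → z ≢ l → z ≢ compl l → z ∈ R) (C ++ D)

resolutionStep? : ∀ C D R l → Dec (ResolutionStep C D R l)
resolutionStep? C D R l = (l ∈? C) ×-dec (compl l ∈? D)
  ×-dec All.all? (λ z → (compl z ∈? D) →-dec (z ≟L l)) C
  ×-dec All.all? (λ z → ((z ∈? C) ⊎-dec (z ∈? D)) ×-dec ¬? (z ≟L l) ×-dec ¬? (z ≟L compl l)) R
  ×-dec All.all? (λ z → ¬? (z ≟L l) →-dec ¬? (z ≟L compl l) →-dec (z ∈? R)) (C ++ D)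

ResolutionStep⇒Resolves : ∀ {C D R l} → ResolutionStep C D R l → Resolves C D R
ResolutionStep⇒Resolves {C} {D} {R} {l} (l∈C , l̄∈D , unique , inR , toR) = record
  { lit = l ; inC = l∈C ; inD = l̄∈D
  ; unique = λ z mz mcz → All.lookup unique mz mcz
  ; resolvent = λ z → (λ m → All.lookup inR m) ,
      (λ { (inj₁ m , n₁ , n₂) → All.lookup toR (∈-++⁺ˡ m) n₁ n₂
         ; (inj₂ m , n₁ , n₂) → All.lookup toR (∈-++⁺ʳ C m) n₁ n₂ }) }

Differ : Clause → Clause → Set
Differ C D = ¬ (All (_∈ D) C × All (_∈ C) D)

differ? : ∀ C D → Dec (Differ C D)
differ? C D = ¬? (All.all? (_∈? D) C ×-dec All.all? (_∈? C) D)

Differ⇒¬SetEq : ∀ {C D} → Differ C D → ¬ SetEq C D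
Differ⇒¬SetEq differ s = differ (All.tabulate (λ {z} → proj₁ (s z)) , All.tabulate (λ {z} → proj₂ (s z)))

Distinct : Clause → Clause → Set
Distinct C D = ¬ SetEq C D

shift-distinct : ∀ j {Cs} → AllPairs Differ Cs → AllPairs Distinct (map (shiftC j) Cs)
shift-distinct j ds = AllPairs.map⁺ (AllPairs.map (λ differ s → Differ⇒¬SetEq differ (SetEq-unshift j s)) ds)

-- Splitting C₁ (resp. C₂) along v₁ … v_{3+k}
-- gives the chain  first a, shiftC j (middle a) for j < k, shiftC k (last a L)
-- with a = 1, L = v₃ (resp. a = 2, L = ¬v₃); y a i is the auxiliary
-- variable y_i of chain a.
first : ℕ → Clause
first a = pos (v 1) ∷ pos (v 2) ∷ pos (y a 2) ∷ []

middle : ℕ → Clause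
middle a = pos (y a 2) ∷ pos (v 3) ∷ pos (y a 3) ∷ []

last : ℕ → Lit → Clause
last a L = pos (y a 2) ∷ L ∷ []

middles : ℕ → ℕ → List Clause
middles a k = applyUpTo (λ j → shiftC j (middle a)) k

chain : ℕ → Lit → ℕ → List Clause
chain a L k = first a ∷ (middles a k ++ [ shiftC k (last a L) ])

blocks : ℕ → List Clause
blocks k = chain 1 (pos (v 3)) k ++ chain 2 (neg (v 3)) k

T′ : ℕ → ClauseSet
T′ k = concatMap X₀ (blocks k)

applyUpTo-cong : ∀ {A : Set} {f g : ℕ → A} k → (∀ j → f j ≡ g j) → applyUpTo f k ≡ applyUpTo g k
applyUpTo-cong zero _ = refl
applyUpTo-cong (suc k) f≗g = cong₂ _∷_ (f≗g 0) (applyUpTo-cong k (f≗g ∘ suc))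

splitChain-applyUpTo : ∀ a L (h : ℕ → Lit) o k →
  splitChain (y a) (3 + o) (pos (y a (2 + o))) (applyUpTo h k ++ [ L ])
  ≡ applyUpTo (λ j → pos (y a (2 + (j + o))) ∷ h j ∷ pos (y a (3 + (j + o))) ∷ []) k
    ++ [ pos (y a (2 + (k + o))) ∷ L ∷ [] ]
splitChain-applyUpTo a L h o zero = refl
splitChain-applyUpTo a L h o (suc zero) = refl
splitChain-applyUpTo a L h o (suc (suc k)) = cong (_ ∷_) (trans
  (splitChain-applyUpTo a L (h ∘ suc) (suc o) (suc k))
  (cong₂ (λ xs i → xs ++ [ pos (y a (2 + i)) ∷ L ∷ [] ])
    (applyUpTo-cong (suc k) (λ j → cong (λ i → pos (y a (2 + i)) ∷ h (suc j) ∷ pos (y a (3 + i)) ∷ []) (+-suc j o)))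
    (+-suc (suc k) o)))

natSplit-chain : ∀ a L k →
  natSplit (y a) (pos (v 1) ∷ pos (v 2) ∷ (applyUpTo (λ j → pos (v (3 + j))) k ++ [ shiftL k L ]))
  ≡ chain a L k
natSplit-chain a L zero = refl
natSplit-chain a L (suc k) = cong (first a ∷_) (trans
  (splitChain-applyUpTo a (shiftL (suc k) L) (λ j → pos (v (3 + j))) 0 (suc k))
  (cong₂ (λ xs i → xs ++ [ pos (y a (2 + i)) ∷ shiftL (suc k) L ∷ [] ])
    (applyUpTo-cong (suc k) (λ j → cong (λ i → pos (y a (2 + i)) ∷ pos (v (3 + j)) ∷ pos (y a (3 + i)) ∷ []) (+-identityʳ j)))
    (+-identityʳ (suc k))))

C₁-shape : ∀ k → C₁ (3 + k) ≡ pos (v 1) ∷ pos (v 2) ∷ (applyUpTo (λ j → pos (v (3 + j))) k ++ [ pos (v (3 + k)) ])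
C₁-shape k = trans (map-upTo _ (3 + k)) (cong (λ xs → pos (v 1) ∷ pos (v 2) ∷ xs) (sym (applyUpTo-∷ʳ _ k)))

C₂-shape : ∀ k → C₂ (3 + k) ≡ pos (v 1) ∷ pos (v 2) ∷ (applyUpTo (λ j → pos (v (3 + j))) k ++ [ neg (v (3 + k)) ])
C₂-shape k = cong (_++ [ neg (v (3 + k)) ]) (map-upTo _ (2 + k))

T-normal-form : ∀ k → T (3 + k) ≡ T′ k
T-normal-form k = begin
  concatMap X₀ (natSplit (y 1) (C₁ (3 + k))) ++ concatMap X₀ (natSplit (y 2) (C₂ (3 + k)))
    ≡⟨ cong₂ (λ A B → concatMap X₀ (natSplit (y 1) A) ++ concatMap X₀ (natSplit (y 2) B)) (C₁-shape k) (C₂-shape k) ⟩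
  concatMap X₀ (natSplit (y 1) (prefix ++ [ pos (v (3 + k)) ])) ++ concatMap X₀ (natSplit (y 2) (prefix ++ [ neg (v (3 + k)) ]))
    ≡⟨ cong₂ (λ A B → concatMap X₀ A ++ concatMap X₀ B) (natSplit-chain 1 (pos (v 3)) k) (natSplit-chain 2 (neg (v 3)) k) ⟩
  concatMap X₀ (chain 1 (pos (v 3)) k) ++ concatMap X₀ (chain 2 (neg (v 3)) k)
    ≡⟨ sym (concatMap-++ X₀ (chain 1 (pos (v 3)) k) (chain 2 (neg (v 3)) k)) ⟩
  T′ k ∎
  where
  open ≡-Reasoning
  prefix : List Lit
  prefix = pos (v 1) ∷ pos (v 2) ∷ applyUpTo (λ j → pos (v (3 + j))) k

data Block (k : ℕ) : Clause → Set where
  first₁ : Block k (first 1)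
  first₂ : Block k (first 2)
  middle₁ : ∀ j → j < k → Block k (shiftC j (middle 1))
  middle₂ : ∀ j → j < k → Block k (shiftC j (middle 2))
  last₁ : Block k (shiftC k (last 1 (pos (v 3))))
  last₂ : Block k (shiftC k (last 2 (neg (v 3))))

blocks-classified : ∀ k → All (Block k) (blocks k)
blocks-classified k =
  All.++⁺ (first₁ ∷ All.++⁺ (All.applyUpTo⁺₁ _ k (middle₁ _)) (last₁ ∷ []))
          (first₂ ∷ All.++⁺ (All.applyUpTo⁺₁ _ k (middle₂ _)) (last₂ ∷ []))

Block⇒∈blocks : ∀ {k d} → Block k d → d ∈ blocks k
Block⇒∈blocks first₁ = here refl
Block⇒∈blocks {k} first₂ = ∈-++⁺ʳ (chain 1 (pos (v 3)) k) (here refl)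
Block⇒∈blocks (middle₁ j j<k) = there (∈-++⁺ˡ (∈-++⁺ˡ (∈-applyUpTo⁺ _ j<k)))
Block⇒∈blocks {k} (middle₂ j j<k) = ∈-++⁺ʳ (chain 1 (pos (v 3)) k) (there (∈-++⁺ˡ (∈-applyUpTo⁺ _ j<k)))
Block⇒∈blocks {k} last₁ = there (∈-++⁺ˡ (∈-++⁺ʳ (middles 1 k) (here refl)))
Block⇒∈blocks {k} last₂ = ∈-++⁺ʳ (chain 1 (pos (v 3)) k) (there (∈-++⁺ʳ (middles 2 k) (here refl)))

∈T′ : ∀ {k d C} → Block k d → C ∈ X₀ d → C ∈ T′ k
∈T′ b mC = ∈-concatMap⁺ X₀ (Any.map (λ { refl → mC }) (Block⇒∈blocks b))

All-T′ : ∀ {P : Clause → Set} k → (∀ {d} → Block k d → All P (X₀ d)) → All P (T′ k)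
All-T′ k f = All.concat⁺ (All.map⁺ (All.map f (blocks-classified k)))

All-T′⁻ : ∀ {P : Clause → Set} {k d} → All P (T′ k) → Block k d → All P (X₀ d)
All-T′⁻ {k = k} a b = All.lookup (All.map⁻ (All.concat⁻ {xss = map X₀ (blocks k)} a)) (Block⇒∈blocks b)

allSigns-vars : ∀ xs → All (λ D → map var D ≡ xs) (allSigns xs)
allSigns-vars [] = refl ∷ []
allSigns-vars (x ∷ xs) = All.++⁺ (All.map⁺ (All.map (cong (x ∷_)) (allSigns-vars xs)))
                                 (All.map⁺ (All.map (cong (x ∷_)) (allSigns-vars xs)))

X₀-vars : ∀ C → All (λ D → map var D ≡ map var C) (X₀ C)
X₀-vars C = All.filter⁺ _ (allSigns-vars (map var C))

X₀-length : ∀ C → All (λ D → length D ≡ length C) (X₀ C)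
X₀-length C = All.map (λ {D} e → trans (sym (length-map var D)) (trans (cong length e) (length-map var C))) (X₀-vars C)

-- Satisfiability of X₀ of short positive clauses: X₀ C says that the sum of
-- the variables of C is 0.  Evaluating a concrete clause-set as a Boolean and
-- using a generic valuation of three variables, these are finite truth tables.
satisfiesᵇ : (Var → Bool) → ClauseSet → Bool
satisfiesᵇ β F = all (any (evalL β)) F

SatC⇒anyᵇ : ∀ β {C} → SatC β C → any (evalL β) C ≡ true
SatC⇒anyᵇ β (here e) rewrite e = refl
SatC⇒anyᵇ β {l ∷ _} (there s) with evalL β l
... | true = refl
... | false = SatC⇒anyᵇ β s

satisfiesᵇ-complete : ∀ β {F} → All (SatC β) F → satisfiesᵇ β F ≡ true
satisfiesᵇ-complete β [] = refl
satisfiesᵇ-complete β (sat ∷ sats) rewrite SatC⇒anyᵇ β sat = satisfiesᵇ-complete β sats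

generic : Bool → Bool → Bool → Var → Bool
generic p q r (v 0) = p
generic p q r (v 1) = q
generic p q r (v 2) = r
generic p q r _ = false

xor3-table : ∀ p q r → satisfiesᵇ (generic p q r) (X₀ (pos (v 0) ∷ pos (v 1) ∷ pos (v 2) ∷ [])) ≡ true → r ≡ p xor q
xor3-table true true true ()
xor3-table true true false _ = refl
xor3-table true false true _ = refl
xor3-table true false false ()
xor3-table false true true _ = refl
xor3-table false true false ()
xor3-table false false true ()
xor3-table false false false _ = refl

xor2-table : ∀ p q → satisfiesᵇ (generic p q false) (X₀ (pos (v 0) ∷ pos (v 1) ∷ [])) ≡ true → p ≡ q
xor2-table true true _ = refl
xor2-table true false ()
xor2-table false true ()
xor2-table false false _ = refl

xor2¬-table : ∀ p q → satisfiesᵇ (generic p q false) (X₀ (pos (v 0) ∷ neg (v 1) ∷ [])) ≡ true → p ≡ not q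
xor2¬-table true true ()
xor2¬-table true false _ = refl
xor2¬-table false true _ = refl
xor2¬-table false false ()

X₀-xor3 : ∀ β a b c → All (SatC β) (X₀ (pos a ∷ pos b ∷ pos c ∷ [])) → β c ≡ β a xor β b
X₀-xor3 β a b c sat = xor3-table (β a) (β b) (β c) (satisfiesᵇ-complete β sat)

X₀-xor2 : ∀ β a b → All (SatC β) (X₀ (pos a ∷ pos b ∷ [])) → β a ≡ β b
X₀-xor2 β a b sat = xor2-table (β a) (β b) (satisfiesᵇ-complete β sat)

X₀-xor2¬ : ∀ β a b → All (SatC β) (X₀ (pos a ∷ neg b ∷ [])) → β a ≡ not (β b)
X₀-xor2¬ β a b sat = xor2¬-table (β a) (β b) (satisfiesᵇ-complete β sat)

not-fixed : ∀ b → b ≢ not b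
not-fixed true ()
not-fixed false ()

-- Unsatisfiability: a model makes the two chains agree, y¹ᵢ = y²ᵢ, from
-- y¹₂ = v₁ ⊕ v₂ = y²₂ on along the middle blocks; but the last blocks say
-- y¹ = v_n and y² = ¬v_n.
T′-unsat : ∀ k → Unsat (T′ k)
T′-unsat k α sat = not-fixed (α (v (3 + k))) (begin
  α (v (3 + k))      ≡⟨ sym (X₀-xor2 α _ _ (holds last₁)) ⟩
  α (y 1 (2 + k))    ≡⟨ chains-agree k ≤-refl ⟩
  α (y 2 (2 + k))    ≡⟨ X₀-xor2¬ α _ _ (holds last₂) ⟩
  not (α (v (3 + k))) ∎)
  where
  open ≡-Reasoning
  holds : ∀ {d} → Block k d → All (SatC α) (X₀ d)
  holds = All-T′⁻ sat
  chains-agree : ∀ j → j ≤ k → α (y 1 (2 + j)) ≡ α (y 2 (2 + j))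
  chains-agree zero _ = trans (X₀-xor3 α _ _ _ (holds first₁)) (sym (X₀-xor3 α _ _ _ (holds first₂)))
  chains-agree (suc j) j<k = begin
    α (y 1 (3 + j))                   ≡⟨ X₀-xor3 α _ _ _ (holds (middle₁ j j<k)) ⟩
    α (y 1 (2 + j)) xor α (v (3 + j)) ≡⟨ cong (_xor α (v (3 + j))) (chains-agree j (≤-trans (n≤1+n j) j<k)) ⟩
    α (y 2 (2 + j)) xor α (v (3 + j)) ≡⟨ sym (X₀-xor3 α _ _ _ (holds (middle₂ j j<k))) ⟩
    α (y 2 (3 + j))                   ∎

T1-unsat : Unsat (T 1)
T1-unsat α (here ¬x ∷ here x ∷ []) = not-fixed (α (v 1)) (trans x (sym ¬x))
T1-unsat α (there () ∷ _)
T1-unsat α (_ ∷ there () ∷ _)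

T2-unsat : Unsat (T 2)
T2-unsat α sat = not-fixed (α (v 2)) (trans
  (sym (X₀-xor2 α _ _ (All.++⁻ˡ (X₀ (pos (v 1) ∷ pos (v 2) ∷ [])) sat)))
  (X₀-xor2¬ α _ _ (All.++⁻ʳ (X₀ (pos (v 1) ∷ pos (v 2) ∷ [])) sat)))

X₀-size≤ : ∀ d {m} → length d ≤ m → All (λ C → size C ≤ m) (X₀ d)
X₀-size≤ d d≤m = All.map (λ {D} e → ≤-trans (size≤length D) (subst (_≤ _) (sym e) d≤m)) (X₀-length d)

T′-size≤3 : ∀ k → All (λ C → size C ≤ 3) (T′ k)
T′-size≤3 k = All-T′ k λ {d} b → X₀-size≤ d (block-length≤3 b)
  where
  block-length≤3 : ∀ {d} → Block k d → length d ≤ 3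
  block-length≤3 first₁ = ≤-refl
  block-length≤3 first₂ = ≤-refl
  block-length≤3 (middle₁ _ _) = ≤-refl
  block-length≤3 (middle₂ _ _) = ≤-refl
  block-length≤3 last₁ = n≤1+n 2
  block-length≤3 last₂ = n≤1+n 2

-- Resolving two Good clauses one of which has at most two literals (so it is
-- binary) gives a Good clause, while ⊥ is not Good: from Good axioms no
-- refutation has whd ≤ 2.
module LayerInvariant (OnLayer : Var → Set) (val : Var → Bool) where

  valL : Lit → Bool
  valL (pos x) = val x
  valL (neg x) = not (val x)

  valL-compl : ∀ l → valL (compl l) ≡ not (valL l)
  valL-compl (pos x) = refl
  valL-compl (neg x) with val x
  ... | true = refl
  ... | false = refl

  Layer : Lit → Set
  Layer l = OnLayer (var l)

  -- A binary Good clause seen from one of its literals l.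
  record BinaryAt (C : Clause) (l : Lit) : Set where
    field
      other : Lit
      covers : ∀ z → z ∈ C → z ≡ l ⊎ z ≡ other
      other∈ : other ∈ C
      layer : Layer l
      layer-other : Layer other
      vars≢ : var l ≢ var other
      vals≢ : valL l ≢ valL other

  Binary : Clause → Set
  Binary C = Σ Lit λ l → l ∈ C × BinaryAt C l

  binaryAt : ∀ {C l} → Binary C → l ∈ C → BinaryAt C l
  binaryAt (u , u∈C , bu) l∈C with BinaryAt.covers bu _ l∈C
  ... | inj₁ refl = bu
  ... | inj₂ refl = record
    { other = u ; covers = λ z m → swap (covers z m) ; other∈ = u∈C
    ; layer = layer-other ; layer-other = layer
    ; vars≢ = λ e → vars≢ (sym e) ; vals≢ = λ e → vals≢ (sym e) }
    where
    open BinaryAt bu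

  AtMostOneOnLayer : Clause → Set
  AtMostOneOnLayer C = ∀ z w → z ∈ C → w ∈ C → Layer z → Layer w → z ≡ w

  record Wide (C : Clause) : Set where
    field
      a b c : Lit
      a∈ : a ∈ C
      b∈ : b ∈ C
      c∈ : c ∈ C
      a≢b : a ≢ b
      a≢c : a ≢ c
      b≢c : b ≢ c
      one-on-layer : AtMostOneOnLayer C

  Good : Clause → Set
  Good C = Binary C ⊎ Wide C

  differ-via : ∀ p q r → p ≢ r → q ≢ not r → p ≢ q
  differ-via true true true p≢r _ _ = p≢r refl
  differ-via true true false _ q≢¬r _ = q≢¬r refl
  differ-via false false true _ q≢¬r _ = q≢¬r refl
  differ-via false false false p≢r _ _ = p≢r refl

  module _ {C D R : Clause} (r : Resolves C D R) where
    private
      l : Lit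
      l = Resolves.lit r
      into-R : ∀ z → (z ∈ C ⊎ z ∈ D) → z ≢ l → z ≢ compl l → z ∈ R
      into-R z side n₁ n₂ = proj₂ (Resolves.resolvent r z) (side , n₁ , n₂)
      from-R : ∀ z → z ∈ R → (z ∈ C ⊎ z ∈ D) × z ≢ l × z ≢ compl l
      from-R z = proj₁ (Resolves.resolvent r z)

    other∈R : (bC : BinaryAt C l) → BinaryAt.other bC ∈ R
    other∈R bC = into-R other (inj₁ other∈) (λ e → vars≢ (sym (cong var e)))
                   (λ e → vars≢ (sym (trans (cong var e) (var-compl l))))
      where open BinaryAt bC

    resolve-binary-binary : BinaryAt C l → BinaryAt D (compl l) → Binary R
    resolve-binary-binary bC bD = o , other∈R bC , record
      { other = o' ; covers = covers-R ; other∈ = o'∈R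
      ; layer = BinaryAt.layer-other bC ; layer-other = BinaryAt.layer-other bD
      ; vars≢ = vars≢ ; vals≢ = vals≢ }
      where
      o o' : Lit
      o = BinaryAt.other bC
      o' = BinaryAt.other bD
      covers-R : ∀ z → z ∈ R → z ≡ o ⊎ z ≡ o'
      covers-R z m with from-R z m
      ... | inj₁ mC , n₁ , _ with BinaryAt.covers bC z mC
      ...   | inj₁ e = ⊥-elim (n₁ e)
      ...   | inj₂ e = inj₁ e
      covers-R z m | inj₂ mD , _ , n₂ with BinaryAt.covers bD z mD
      ...   | inj₁ e = ⊥-elim (n₂ e)
      ...   | inj₂ e = inj₂ e
      o'∈R : o' ∈ R
      o'∈R = into-R o' (inj₂ (BinaryAt.other∈ bD))
        (λ e → BinaryAt.vars≢ bD (sym (trans (cong var e) (sym (var-compl l)))))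
        (λ e → BinaryAt.vars≢ bD (sym (cong var e)))
      -- o differs from l in value, o' from compl l
      vals≢ : valL o ≢ valL o'
      vals≢ = differ-via (valL o) (valL o') (valL l) (λ e → BinaryAt.vals≢ bC (sym e))
                 (λ e → BinaryAt.vals≢ bD (trans (valL-compl l) (sym e)))
      -- o = compl o' would be a second clashing literal
      vars≢ : var o ≢ var o'
      vars≢ e with sameVar⇒≡⊎compl o o' e
      ... | inj₁ o≡o' = vals≢ (cong valL o≡o')
      ... | inj₂ o≡o'̄ = BinaryAt.vars≢ bC (sym (cong var (Resolves.unique r o (BinaryAt.other∈ bC)
                          (subst (_∈ D) (sym (trans (cong compl o≡o'̄) (compl-involutive o'))) (BinaryAt.other∈ bD)))))

    -- binary ⊛ wide = wide: R keeps the other literal of C (on the layer) and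
    -- the two literals of D besides compl l (off the layer).
    resolve-binary-wide : BinaryAt C l → Wide D → Wide R
    resolve-binary-wide bC wD = pick
      where
      open Wide wD
      o : Lit
      o = BinaryAt.other bC
      l̄-layer : Layer (compl l)
      l̄-layer = subst OnLayer (sym (var-compl l)) (BinaryAt.layer bC)
      survives : ∀ e → e ∈ D → e ≢ compl l → (e ∈ R) × ¬ Layer e
      survives e e∈D e≢l̄ = into-R e (inj₂ e∈D) e≢l e≢l̄ , off
        where
        off : ¬ Layer e
        off layer-e = e≢l̄ (one-on-layer e (compl l) e∈D (Resolves.inD r) layer-e l̄-layer)
        e≢l : e ≢ l
        e≢l refl = l≢compl l (one-on-layer l (compl l) e∈D (Resolves.inD r) (BinaryAt.layer bC) l̄-layer)
      one-on-layer-R : AtMostOneOnLayer R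
      one-on-layer-R z w z∈R w∈R layer-z layer-w = trans (is-o z z∈R layer-z) (sym (is-o w w∈R layer-w))
        where
        is-o : ∀ z → z ∈ R → Layer z → z ≡ o
        is-o z m layer-z with from-R z m
        ... | inj₁ mC , n₁ , _ with BinaryAt.covers bC z mC
        ...   | inj₁ e = ⊥-elim (n₁ e)
        ...   | inj₂ e = e
        is-o z m layer-z | inj₂ mD , _ , n₂ =
          ⊥-elim (n₂ (one-on-layer z (compl l) mD (Resolves.inD r) layer-z l̄-layer))
      from-two : ∀ e₁ e₂ → e₁ ∈ D → e₂ ∈ D → e₁ ≢ e₂ → e₁ ≢ compl l → e₂ ≢ compl l → Wide R
      from-two e₁ e₂ e₁∈D e₂∈D e₁≢e₂ e₁≢l̄ e₂≢l̄ with survives e₁ e₁∈D e₁≢l̄ | survives e₂ e₂∈D e₂≢l̄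
      ... | e₁∈R , off₁ | e₂∈R , off₂ = record
        { a = o ; b = e₁ ; c = e₂ ; a∈ = other∈R bC ; b∈ = e₁∈R ; c∈ = e₂∈R
        ; a≢b = λ e → off₁ (subst Layer e (BinaryAt.layer-other bC))
        ; a≢c = λ e → off₂ (subst Layer e (BinaryAt.layer-other bC))
        ; b≢c = e₁≢e₂ ; one-on-layer = one-on-layer-R }
      pick : Wide R
      pick with a ≟L compl l | b ≟L compl l
      ... | yes refl | _ = from-two b c b∈ c∈ b≢c (λ e → a≢b (sym e)) (λ e → a≢c (sym e))
      ... | no a≢l̄ | yes refl = from-two a c a∈ c∈ a≢c a≢l̄ (λ e → b≢c (sym e))
      ... | no a≢l̄ | no b≢l̄ = from-two a b a∈ b∈ a≢b a≢l̄ b≢l̄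

  Wide-large : ∀ {C} → Wide C → ¬ (size C ≤ 2)
  Wide-large w C≤2 with ≤-trans (three-literals⇒3≤size a∈ b∈ c∈ a≢b a≢c b≢c) C≤2
    where open Wide w
  ... | s≤s (s≤s ())

  resolve-Good : ∀ {C D R} → Resolves C D R → Good C → Good D → (size C ≤ 2 ⊎ size D ≤ 2) → Good R
  resolve-Good r (inj₂ wC) _ (inj₁ C≤2) = ⊥-elim (Wide-large wC C≤2)
  resolve-Good r _ (inj₂ wD) (inj₂ D≤2) = ⊥-elim (Wide-large wD D≤2)
  resolve-Good r (inj₁ bC) (inj₁ bD) _ =
    inj₁ (resolve-binary-binary r (binaryAt bC (Resolves.inC r)) (binaryAt bD (Resolves.inD r)))
  resolve-Good r (inj₁ bC) (inj₂ wD) _ = inj₂ (resolve-binary-wide r (binaryAt bC (Resolves.inC r)) wD)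
  resolve-Good r (inj₂ wC) (inj₁ bD) _ =
    inj₂ (resolve-binary-wide (Resolves-sym r) (binaryAt bD (Resolves.inD r)) wC)

  derivation-Good : ∀ {j F C} → j ≤ 2 → All Good F → WhdDeriv j F C → Good C
  derivation-Good j≤2 good (axiom m) = All.lookup good m
  derivation-Good j≤2 good (resolve d₁ d₂ r small) =
    resolve-Good r (derivation-Good j≤2 good d₁) (derivation-Good j≤2 good d₂) (Sum.map (λ p → ≤-trans p j≤2) (λ p → ≤-trans p j≤2) small)

  ¬Good-⊥ : ¬ Good []
  ¬Good-⊥ (inj₁ (_ , () , _))
  ¬Good-⊥ (inj₂ w) with Wide.a∈ w
  ... | ()

  no-narrow-refutation : ∀ {F} → All Good F → ∀ j → j < 3 → ¬ WhdDeriv j F []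
  no-narrow-refutation good j (s≤s j≤2) d = ¬Good-⊥ (derivation-Good j≤2 good d)

WidDeriv-size : ∀ {j F C} → WidDeriv j F C → size C ≤ j
WidDeriv-size (axiom _ C≤j) = C≤j
WidDeriv-size (resolve _ _ _ R≤j) = R≤j

WidDeriv⇒WhdDeriv : ∀ {j F C} → WidDeriv j F C → WhdDeriv j F C
WidDeriv⇒WhdDeriv (axiom m _) = axiom m
WidDeriv⇒WhdDeriv (resolve d₁ d₂ r _) = resolve (WidDeriv⇒WhdDeriv d₁) (WidDeriv⇒WhdDeriv d₂) r (inj₁ (WidDeriv-size d₁))

-- The layer for T′ k consists of the variables of the last blocks,
-- v (3 + k) and y a (2 + k); the valuation makes v and y¹ true, y² false.
OnLastLayer : ℕ → Var → Set
OnLastLayer k (v i) = i ≡ 3 + k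
OnLastLayer k (y a i) = i ≡ 2 + k

chainValuation : Var → Bool
chainValuation (v _) = true
chainValuation (y a _) = a ≡ᵇ 1

module _ (k : ℕ) where
  open LayerInvariant (OnLastLayer k) chainValuation

  X₀-wide : ∀ d {A B C} → map var d ≡ A ∷ B ∷ C ∷ [] → A ≢ B → A ≢ C → B ≢ C →
            ¬ OnLastLayer k A → ¬ OnLastLayer k B → All Good (X₀ d)
  X₀-wide d {A} {B} {C} vars-d A≢B A≢C B≢C offA offB = All.map (λ {D} e → inj₂ (wide D (trans e vars-d))) (X₀-vars d)
    where
    wide : ∀ D → map var D ≡ A ∷ B ∷ C ∷ [] → Wide D
    wide (l₁ ∷ l₂ ∷ l₃ ∷ []) refl = record
      { a = l₁ ; b = l₂ ; c = l₃ ; a∈ = here refl ; b∈ = there (here refl) ; c∈ = there (there (here refl))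
      ; a≢b = A≢B ∘ cong var ; a≢c = A≢C ∘ cong var ; b≢c = B≢C ∘ cong var
      ; one-on-layer = λ z w z∈ w∈ layer-z layer-w → trans (is-l₃ z∈ layer-z) (sym (is-l₃ w∈ layer-w)) }
      where
      is-l₃ : ∀ {z} → z ∈ l₁ ∷ l₂ ∷ l₃ ∷ [] → Layer z → z ≡ l₃
      is-l₃ (here refl) layer = ⊥-elim (offA layer)
      is-l₃ (there (here refl)) layer = ⊥-elim (offB layer)
      is-l₃ (there (there (here refl))) _ = refl

  binary₂ : ∀ u w → Layer u → Layer w → var u ≢ var w → valL u ≢ valL w → Good (u ∷ w ∷ [])
  binary₂ u w layer-u layer-w vars≢ vals≢ = inj₁ (u , here refl , record
    { other = w ; covers = covers ; other∈ = there (here refl)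
    ; layer = layer-u ; layer-other = layer-w ; vars≢ = vars≢ ; vals≢ = vals≢ })
    where
    covers : ∀ z → z ∈ u ∷ w ∷ [] → z ≡ u ⊎ z ≡ w
    covers z (here e) = inj₁ e
    covers z (there (here e)) = inj₂ e

  T′-Good : All Good (T′ k)
  T′-Good = All-T′ k good
    where
    off : ∀ {j} → j < k → ∀ c → c + j ≢ c + k
    off j<k c e = <⇒≢ j<k (+-cancelˡ-≡ c _ _ e)
    good : ∀ {d} → Block k d → All Good (X₀ d)
    good first₁ = X₀-wide (first 1) refl (λ ()) (λ ()) (λ ()) (λ ()) (λ ())
    good first₂ = X₀-wide (first 2) refl (λ ()) (λ ()) (λ ()) (λ ()) (λ ())
    good (middle₁ j j<k) = X₀-wide (shiftC j (middle 1)) refl (λ ()) (λ e → 1+n≢n (sym (proj₂ (y-injective e)))) (λ ()) (off j<k 2) (off j<k 3)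
    good (middle₂ j j<k) = X₀-wide (shiftC j (middle 2)) refl (λ ()) (λ e → 1+n≢n (sym (proj₂ (y-injective e)))) (λ ()) (off j<k 2) (off j<k 3)
    good last₁ = binary₂ _ _ refl refl (λ ()) (λ ()) ∷ binary₂ _ _ refl refl (λ ()) (λ ()) ∷ []
    good last₂ = binary₂ _ _ refl refl (λ ()) (λ ()) ∷ binary₂ _ _ refl refl (λ ()) (λ ()) ∷ []

  T′-no-narrow-refutation : ∀ j → j < 3 → ¬ WhdDeriv j (T′ k) []
  T′-no-narrow-refutation = no-narrow-refutation T′-Good

data Fragment (A Ctx : List Clause) : List Clause → Set where
  [] : Fragment A Ctx []
  axiom : ∀ {B C} → Fragment A Ctx B → C ∈ A → Fragment A Ctx (C ∷ B)
  resolve : ∀ {B C D R} → Fragment A Ctx B → C ∈ B ++ Ctx → D ∈ B ++ Ctx → Resolves C D R →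
            Fragment A Ctx (R ∷ B)

append-Fragment : ∀ {F A Ctx B L} → ResSeq F L → (∀ {C} → C ∈ A → C ∈ F) → (∀ {C} → C ∈ Ctx → C ∈ L) →
  Fragment A Ctx B → ResSeq F (B ++ L)
append-Fragment seq A⊆F Ctx⊆L [] = seq
append-Fragment seq A⊆F Ctx⊆L (axiom frag m) = axiom (append-Fragment seq A⊆F Ctx⊆L frag) (A⊆F m)
append-Fragment seq A⊆F Ctx⊆L (resolve {B} frag mC mD r) =
  resolve (append-Fragment seq A⊆F Ctx⊆L frag) (earlier mC) (earlier mD) r
  where
  earlier : ∀ {C} → C ∈ B ++ _ → C ∈ B ++ _
  earlier m with ∈-++⁻ B m
  ... | inj₁ mB = ∈-++⁺ˡ mB
  ... | inj₂ mCtx = ∈-++⁺ʳ B (Ctx⊆L mCtx)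

Fragment-shift : ∀ j {A Ctx B} → Fragment A Ctx B → Fragment (map (shiftC j) A) (map (shiftC j) Ctx) (map (shiftC j) B)
Fragment-shift j [] = []
Fragment-shift j (axiom frag m) = axiom (Fragment-shift j frag) (∈-map⁺ (shiftC j) m)
Fragment-shift j {Ctx = Ctx} (resolve {B} frag mC mD r) =
  resolve (Fragment-shift j frag) (shifted mC) (shifted mD) (Resolves-shift j r)
  where
  shifted : ∀ {C} → C ∈ B ++ Ctx → shiftC j C ∈ map (shiftC j) B ++ map (shiftC j) Ctx
  shifted m = subst (shiftC j _ ∈_) (map-++ (shiftC j) B Ctx) (∈-map⁺ (shiftC j) m)

record Step : Set where
  constructor resolving
  field
    left right resolvent : Clause
    pivot : Lit
open Step

infixl 5 _+ax_ _+res_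

_+ax_ : ∀ {A Ctx B} → Fragment A Ctx B → (C : Clause) → {C∈A : True (C ∈?ᶜ A)} → Fragment A Ctx (C ∷ B)
(frag +ax C) {C∈A} = axiom frag (toWitness C∈A)

_+res_ : ∀ {A Ctx B} → Fragment A Ctx B → (s : Step) →
  {left∈ : True (left s ∈?ᶜ (B ++ Ctx))} → {right∈ : True (right s ∈?ᶜ (B ++ Ctx))} →
  {step : True (resolutionStep? (left s) (right s) (resolvent s) (pivot s))} → Fragment A Ctx (resolvent s ∷ B)
(frag +res s) {left∈} {right∈} {step} =
  resolve frag (toWitness left∈) (toWitness right∈) (ResolutionStep⇒Resolves (toWitness step))

-- The equivalence y¹₂ ↔ y²₂, as two binary clauses: the invariant carried
-- from layer to layer by the refutation.
linked⁺ linked⁻ : Clause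
linked⁺ = neg (y 1 2) ∷ pos (y 2 2) ∷ []
linked⁻ = pos (y 1 2) ∷ neg (y 2 2) ∷ []

linked : List Clause
linked = linked⁺ ∷ linked⁻ ∷ []

-- From the first blocks (y¹₂ = v₁ ⊕ v₂ = y²₂) derive y¹₂ ↔ y²₂.
firstFragment : Σ (List Clause) (Fragment (X₀ (first 1) ++ X₀ (first 2)) [])
firstFragment = _ , ([]
    +ax (pos x1 ∷ pos x2 ∷ neg a ∷ [])
    +ax (neg x1 ∷ pos x2 ∷ pos b ∷ [])
    +res resolving (pos x1 ∷ pos x2 ∷ neg a ∷ []) (neg x1 ∷ pos x2 ∷ pos b ∷ []) (pos x2 ∷ neg a ∷ pos b ∷ []) (pos x1)
    +ax (neg x1 ∷ neg x2 ∷ neg a ∷ [])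
    +ax (pos x1 ∷ neg x2 ∷ pos b ∷ [])
    +res resolving (neg x1 ∷ neg x2 ∷ neg a ∷ []) (pos x1 ∷ neg x2 ∷ pos b ∷ []) (neg x2 ∷ neg a ∷ pos b ∷ []) (neg x1)
    +res resolving (pos x2 ∷ neg a ∷ pos b ∷ []) (neg x2 ∷ neg a ∷ pos b ∷ []) (neg a ∷ pos b ∷ []) (pos x2)
    +ax (pos x1 ∷ neg x2 ∷ pos a ∷ [])
    +ax (neg x1 ∷ neg x2 ∷ neg b ∷ [])
    +res resolving (pos x1 ∷ neg x2 ∷ pos a ∷ []) (neg x1 ∷ neg x2 ∷ neg b ∷ []) (neg x2 ∷ pos a ∷ neg b ∷ []) (pos x1)
    +ax (neg x1 ∷ pos x2 ∷ pos a ∷ [])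
    +ax (pos x1 ∷ pos x2 ∷ neg b ∷ [])
    +res resolving (neg x1 ∷ pos x2 ∷ pos a ∷ []) (pos x1 ∷ pos x2 ∷ neg b ∷ []) (pos x2 ∷ pos a ∷ neg b ∷ []) (neg x1)
    +res resolving (pos x2 ∷ pos a ∷ neg b ∷ []) (neg x2 ∷ pos a ∷ neg b ∷ []) (pos a ∷ neg b ∷ []) (pos x2))
  where
  x1 x2 a b : Var
  x1 = v 1
  x2 = v 2
  a = y 1 2
  b = y 2 2

-- From y¹₂ ↔ y²₂ and the middle blocks (y^a₃ = y^a₂ ⊕ v₃) derive y¹₃ ↔ y²₃.
middleFragment : Σ (List Clause) (Fragment (X₀ (middle 1) ++ X₀ (middle 2)) linked)
middleFragment = _ , ([]
    +ax (pos a ∷ pos x ∷ neg a' ∷ [])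
    +res resolving (pos a ∷ pos x ∷ neg a' ∷ []) linked⁺ (pos x ∷ neg a' ∷ pos b ∷ []) (pos a)
    +ax (neg b ∷ pos x ∷ pos b' ∷ [])
    +res resolving (pos x ∷ neg a' ∷ pos b ∷ []) (neg b ∷ pos x ∷ pos b' ∷ []) (pos x ∷ neg a' ∷ pos b' ∷ []) (pos b)
    +ax (neg a ∷ neg x ∷ neg a' ∷ [])
    +res resolving (neg a ∷ neg x ∷ neg a' ∷ []) linked⁻ (neg x ∷ neg a' ∷ neg b ∷ []) (neg a)
    +ax (pos b ∷ neg x ∷ pos b' ∷ [])
    +res resolving (neg x ∷ neg a' ∷ neg b ∷ []) (pos b ∷ neg x ∷ pos b' ∷ []) (neg x ∷ neg a' ∷ pos b' ∷ []) (neg b)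
    +res resolving (pos x ∷ neg a' ∷ pos b' ∷ []) (neg x ∷ neg a' ∷ pos b' ∷ []) (neg a' ∷ pos b' ∷ []) (pos x)
    +ax (pos a ∷ neg x ∷ pos a' ∷ [])
    +res resolving (pos a ∷ neg x ∷ pos a' ∷ []) linked⁺ (neg x ∷ pos a' ∷ pos b ∷ []) (pos a)
    +ax (neg b ∷ neg x ∷ neg b' ∷ [])
    +res resolving (neg x ∷ pos a' ∷ pos b ∷ []) (neg b ∷ neg x ∷ neg b' ∷ []) (neg x ∷ pos a' ∷ neg b' ∷ []) (pos b)
    +ax (neg a ∷ pos x ∷ pos a' ∷ [])
    +res resolving (neg a ∷ pos x ∷ pos a' ∷ []) linked⁻ (pos x ∷ pos a' ∷ neg b ∷ []) (neg a)
    +ax (pos b ∷ pos x ∷ neg b' ∷ [])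
    +res resolving (pos x ∷ pos a' ∷ neg b ∷ []) (pos b ∷ pos x ∷ neg b' ∷ []) (pos x ∷ pos a' ∷ neg b' ∷ []) (neg b)
    +res resolving (pos x ∷ pos a' ∷ neg b' ∷ []) (neg x ∷ pos a' ∷ neg b' ∷ []) (pos a' ∷ neg b' ∷ []) (pos x))
  where
  a a' b b' x : Var
  a = y 1 2
  a' = y 1 3
  b = y 2 2
  b' = y 2 3
  x = v 3

-- From y¹₂ ↔ y²₂ and the last blocks (y¹₂ = v₃, y²₂ = ¬v₃) derive v₃ and ¬v₃;
-- the two final binary resolvents complete the count of 18n − 29 clauses.
lastFragment : Σ (List Clause) (Fragment (X₀ (last 1 (pos (v 3))) ++ X₀ (last 2 (neg (v 3)))) linked)
lastFragment = _ , ([]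
    +ax (neg b ∷ neg x ∷ [])
    +res resolving linked⁺ (neg b ∷ neg x ∷ []) (neg a ∷ neg x ∷ []) (pos b)
    +ax (pos a ∷ neg x ∷ [])
    +res resolving (pos a ∷ neg x ∷ []) (neg a ∷ neg x ∷ []) (neg x ∷ []) (pos a)
    +ax (pos b ∷ pos x ∷ [])
    +res resolving linked⁻ (pos b ∷ pos x ∷ []) (pos a ∷ pos x ∷ []) (neg b)
    +ax (neg a ∷ pos x ∷ [])
    +res resolving (pos a ∷ pos x ∷ []) (neg a ∷ pos x ∷ []) (pos x ∷ []) (pos a)
    +res resolving (pos a ∷ neg x ∷ []) linked⁺ (neg x ∷ pos b ∷ []) (pos a)
    +res resolving (neg a ∷ pos x ∷ []) linked⁻ (pos x ∷ neg b ∷ []) (neg a))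
  where
  a b x : Var
  a = y 1 2
  b = y 2 2
  x = v 3

B₀ Bₘ Bₗ : List Clause
B₀ = proj₁ firstFragment
Bₘ = proj₁ middleFragment
Bₗ = proj₁ lastFragment

upToLayer : ℕ → List Clause
upToLayer zero = B₀
upToLayer (suc j) = map (shiftC j) Bₘ ++ upToLayer j

refutation : ℕ → List Clause
refutation k = [] ∷ (map (shiftC k) Bₗ ++ upToLayer k)

linked-derived : ∀ j {C} → C ∈ map (shiftC j) linked → C ∈ upToLayer j
linked-derived zero (here refl) = toWitness {a? = linked⁺ ∈?ᶜ B₀} _
linked-derived zero (there (here refl)) = toWitness {a? = linked⁻ ∈?ᶜ B₀} _
linked-derived (suc j) (here refl) =
  ∈-++⁺ˡ (∈-map⁺ (shiftC j) (toWitness {a? = shiftC 1 linked⁺ ∈?ᶜ Bₘ} _))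
linked-derived (suc j) (there (here refl)) =
  ∈-++⁺ˡ (∈-map⁺ (shiftC j) (toWitness {a? = shiftC 1 linked⁻ ∈?ᶜ Bₘ} _))

module _ (k : ℕ) where

  pair-∈T′ : ∀ {d₁ d₂} → Block k d₁ → Block k d₂ → ∀ {C} → C ∈ X₀ d₁ ++ X₀ d₂ → C ∈ T′ k
  pair-∈T′ {d₁} b₁ b₂ m with ∈-++⁻ (X₀ d₁) m
  ... | inj₁ m₁ = ∈T′ b₁ m₁
  ... | inj₂ m₂ = ∈T′ b₂ m₂

  -- The middle and last fragments, shifted, only use clauses of T′ k
  -- (shifting commutes with X₀ on these concrete blocks by computation).
  middle-axioms : ∀ j → j < k → ∀ {C} → C ∈ map (shiftC j) (X₀ (middle 1) ++ X₀ (middle 2)) → C ∈ T′ k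
  middle-axioms j j<k {C} m =
    pair-∈T′ (middle₁ j j<k) (middle₂ j j<k) (subst (C ∈_) (map-++ (shiftC j) (X₀ (middle 1)) (X₀ (middle 2))) m)

  last-axioms : ∀ {C} → C ∈ map (shiftC k) (X₀ (last 1 (pos (v 3))) ++ X₀ (last 2 (neg (v 3)))) → C ∈ T′ k
  last-axioms {C} m =
    pair-∈T′ last₁ last₂ (subst (C ∈_) (map-++ (shiftC k) (X₀ (last 1 (pos (v 3)))) (X₀ (last 2 (neg (v 3))))) m)

  upToLayer-ResSeq : ∀ j → j ≤ k → ResSeq (T′ k) (upToLayer j)
  upToLayer-ResSeq zero _ = append-Fragment [] (pair-∈T′ first₁ first₂) (λ ()) (proj₂ firstFragment)
  upToLayer-ResSeq (suc j) j<k = append-Fragment (upToLayer-ResSeq j (≤-trans (n≤1+n j) j<k))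
    (middle-axioms j j<k) (linked-derived j) (Fragment-shift j (proj₂ middleFragment))

  refutation-ResSeq : ResSeq (T′ k) (refutation k)
  refutation-ResSeq = resolve
    (append-Fragment (upToLayer-ResSeq k ≤-refl) last-axioms (linked-derived k) (Fragment-shift k (proj₂ lastFragment)))
    (∈-++⁺ˡ (∈-map⁺ (shiftC k) (toWitness {a? = (pos (v 3) ∷ []) ∈?ᶜ Bₗ} _)))
    (∈-++⁺ˡ (∈-map⁺ (shiftC k) (toWitness {a? = (neg (v 3) ∷ []) ∈?ᶜ Bₗ} _)))
    (Resolves-shift k unit-clash)
    where
    unit-clash : Resolves (pos (v 3) ∷ []) (neg (v 3) ∷ []) []
    unit-clash = ResolutionStep⇒Resolves (toWitness {a? = resolutionStep? (pos (v 3) ∷ []) (neg (v 3) ∷ []) [] (pos (v 3))} _)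

ResSeq⇒WidDeriv : ∀ {w F L} → ResSeq F L → All (λ C → size C ≤ w) L → ∀ {C} → C ∈ L → WidDeriv w F C
ResSeq⇒WidDeriv (axiom seq m) (C≤w ∷ _) (here refl) = axiom m C≤w
ResSeq⇒WidDeriv (resolve seq mC mD r) (R≤w ∷ sizes) (here refl) =
  resolve (ResSeq⇒WidDeriv seq sizes mC) (ResSeq⇒WidDeriv seq sizes mD) r R≤w
ResSeq⇒WidDeriv (axiom seq _) (_ ∷ sizes) (there m) = ResSeq⇒WidDeriv seq sizes m
ResSeq⇒WidDeriv (resolve seq _ _ _) (_ ∷ sizes) (there m) = ResSeq⇒WidDeriv seq sizes m

Lengths≤3 : List Clause → Set
Lengths≤3 Cs = All (λ C → length C ≤ 3) Cs

lengths≤3? : ∀ Cs → Dec (Lengths≤3 Cs)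
lengths≤3? = All.all? (λ C → length C ≤? 3)

shift-lengths≤3 : ∀ j {Cs} → Lengths≤3 Cs → Lengths≤3 (map (shiftC j) Cs)
shift-lengths≤3 j ls = All.map⁺ (All.map (λ {C} C≤3 → subst (_≤ 3) (sym (length-map (shiftL j) C)) C≤3) ls)

upToLayer-lengths≤3 : ∀ j → Lengths≤3 (upToLayer j)
upToLayer-lengths≤3 zero = toWitness {a? = lengths≤3? B₀} _
upToLayer-lengths≤3 (suc j) = All.++⁺ (shift-lengths≤3 j (toWitness {a? = lengths≤3? Bₘ} _)) (upToLayer-lengths≤3 j)

refutation-sizes≤3 : ∀ k → All (λ C → size C ≤ 3) (refutation k)
refutation-sizes≤3 k = z≤n ∷ All.map (λ {C} C≤3 → ≤-trans (size≤length C) C≤3)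
  (All.++⁺ (shift-lengths≤3 k (toWitness {a? = lengths≤3? Bₗ} _)) (upToLayer-lengths≤3 k))

-- The refutation has 18 (3 + k) ∸ 29 clauses: |B₀| = 14, |Bₘ| = 18, |Bₗ| = 10.
length-upToLayer : ∀ j → length (upToLayer j) ≡ 14 + j * 18
length-upToLayer zero = refl
length-upToLayer (suc j) = begin
  length (map (shiftC j) Bₘ ++ upToLayer j)           ≡⟨ length-++ (map (shiftC j) Bₘ) {upToLayer j} ⟩
  length (map (shiftC j) Bₘ) + length (upToLayer j)   ≡⟨ cong₂ _+_ (length-map (shiftC j) Bₘ) (length-upToLayer j) ⟩
  18 + (14 + j * 18)                                  ≡⟨⟩
  14 + suc j * 18                                     ∎
  where open ≡-Reasoning

length-refutation : ∀ k → length (refutation k) ≡ 18 * (3 + k) ∸ 29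
length-refutation k = begin
  length (refutation k)                                     ≡⟨ cong suc (length-++ (map (shiftC k) Bₗ) {upToLayer k}) ⟩
  suc (length (map (shiftC k) Bₗ) + length (upToLayer k))  ≡⟨ cong₂ (λ a b → suc (a + b)) (length-map (shiftC k) Bₗ) (length-upToLayer k) ⟩
  25 + k * 18                                               ≡⟨ cong (25 +_) (*-comm k 18) ⟩
  25 + 18 * k                                               ≡⟨ sym (cong (_∸ 29) (*-distribˡ-+ 18 3 k)) ⟩
  18 * (3 + k) ∸ 29                                         ∎
  where open ≡-Reasoning

-- Index the variables by v i ↦ 2i and
-- y a i ↦ 2i + 1 (shifting by j adds 2j).  A clause containing a literal of
-- index m differs from every clause all of whose literals have index < m.
index : Var → ℕ
index (v i) = i + i
index (y a i) = suc (i + i)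

Reaches : ℕ → Clause → Set
Reaches m C = Any (λ z → index (var z) ≡ m) C

Below : ℕ → Clause → Set
Below m C = All (λ z → index (var z) ≤ m) C

Topped : ℕ → Clause → Set
Topped m C = Reaches m C × Below m C

topped? : ∀ m C → Dec (Topped m C)
topped? m C = Any.any? (λ z → index (var z) ≟ m) C ×-dec All.all? (λ z → index (var z) ≤? m) C

Reaches⇒Below⇒¬SetEq : ∀ {m m' C D} → Reaches m C → Below m' D → m' < m → ¬ SetEq C D
Reaches⇒Below⇒¬SetEq {m} {m'} reaches below m'<m s with find reaches
... | z , z∈C , refl = <⇒≱ m'<m (All.lookup below (proj₁ (s z) z∈C))

index-shift : ∀ j x → index (shiftV j x) ≡ index x + (j + j)
index-shift j (v i) = interchange i j i j
index-shift j (y a i) = cong suc (interchange i j i j)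

var-shift : ∀ j l → var (shiftL j l) ≡ shiftV j (var l)
var-shift j (pos x) = refl
var-shift j (neg x) = refl

indexL-shift : ∀ j l → index (var (shiftL j l)) ≡ index (var l) + (j + j)
indexL-shift j l = trans (cong index (var-shift j l)) (index-shift j (var l))

Topped-shift : ∀ j {m C} → Topped m C → Topped (m + (j + j)) (shiftC j C)
Topped-shift j (reaches , below) =
  Any.map⁺ (Any.map (λ {l} e → trans (indexL-shift j l) (cong (_+ (j + j)) e)) reaches) ,
  All.map⁺ (All.map (λ {l} l≤m → subst (_≤ _) (sym (indexL-shift j l)) (+-monoˡ-≤ (j + j) l≤m)) below)

Occupied : Clause → Set
Occupied C = Σ Lit (_∈ C)

Reaches⇒Occupied : ∀ {m C} → Reaches m C → Occupied C
Reaches⇒Occupied reaches with find reaches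
... | z , z∈C , _ = z , z∈C

-- The template fragments consist of different clauses, with largest
-- index 5 (B₀, reaching y^a₂), 7 (Bₘ, reaching y^a₃) and 6 (Bₗ, reaching v₃).
B₀-differ : AllPairs Differ B₀
B₀-differ = toWitness {a? = AllPairs.allPairs? differ? B₀} _

Bₘ-differ : AllPairs Differ Bₘ
Bₘ-differ = toWitness {a? = AllPairs.allPairs? differ? Bₘ} _

Bₗ-differ : AllPairs Differ Bₗ
Bₗ-differ = toWitness {a? = AllPairs.allPairs? differ? Bₗ} _

B₀-topped : All (Topped 5) B₀
B₀-topped = toWitness {a? = All.all? (topped? 5) B₀} _

Bₘ-topped : All (Topped 7) Bₘ
Bₘ-topped = toWitness {a? = All.all? (topped? 7) Bₘ} _

Bₗ-topped : All (Topped 6) Bₗ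
Bₗ-topped = toWitness {a? = All.all? (topped? 6) Bₗ} _

-- Up to layer j all clauses are different, occupied and of index ≤ 5 + 2j;
-- the clauses added at layer j + 1 all reach index 7 + 2j.
upToLayer-distinct : ∀ j → AllPairs Distinct (upToLayer j) × All (λ C → Below (5 + (j + j)) C × Occupied C) (upToLayer j)
upToLayer-distinct zero = AllPairs.map Differ⇒¬SetEq B₀-differ , All.map (λ (r , b) → b , Reaches⇒Occupied r) B₀-topped
upToLayer-distinct (suc j) =
  AllPairs.++⁺ (shift-distinct j Bₘ-differ) old-distinct new≠old ,
  All.++⁺ (All.map⁺ (All.map (λ {C} t → let (r , b) = Topped-shift j t in
                                    subst (λ m → Below m (shiftC j C)) bound b , Reaches⇒Occupied r) Bₘ-topped))
          (All.map (λ (b , o) → weaken b , o) old-bounded)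
  where
  old-distinct : AllPairs Distinct (upToLayer j)
  old-distinct = proj₁ (upToLayer-distinct j)
  old-bounded : All (λ C → Below (5 + (j + j)) C × Occupied C) (upToLayer j)
  old-bounded = proj₂ (upToLayer-distinct j)
  bound : 7 + (j + j) ≡ 5 + (suc j + suc j)
  bound = cong (6 +_) (sym (+-suc j j))
  weaken : ∀ {C} → Below (5 + (j + j)) C → Below (5 + (suc j + suc j)) C
  weaken = All.map (λ l≤ → ≤-trans l≤ (≤-trans (n≤1+n _) (≤-trans (n≤1+n _) (≤-reflexive bound))))
  new≠old : All (λ C → All (Distinct C) (upToLayer j)) (map (shiftC j) Bₘ)
  new≠old = All.map⁺ (All.map (λ t → All.map (λ (b , _) → Reaches⇒Below⇒¬SetEq (proj₁ (Topped-shift j t)) b (n≤1+n _)) old-bounded) Bₘ-topped)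

refutation-distinct : ∀ k → AllPairs Distinct (refutation k)
refutation-distinct k =
  All.map (λ (z , z∈C) s → ∉[] (proj₂ (s z) z∈C)) occupied ∷
  AllPairs.++⁺ (shift-distinct k Bₗ-differ) (proj₁ (upToLayer-distinct k)) last≠old
  where
  ∉[] : ∀ {z : Lit} → z ∈ [] → ⊥
  ∉[] ()
  occupied : All Occupied (map (shiftC k) Bₗ ++ upToLayer k)
  occupied = All.++⁺ (All.map⁺ (All.map (λ t → Reaches⇒Occupied (proj₁ (Topped-shift k t))) Bₗ-topped))
                     (All.map proj₂ (proj₂ (upToLayer-distinct k)))
  last≠old : All (λ C → All (Distinct C) (upToLayer k)) (map (shiftC k) Bₗ)
  last≠old = All.map⁺ (All.map (λ t → All.map (λ (b , _) → Reaches⇒Below⇒¬SetEq (proj₁ (Topped-shift k t)) b ≤-refl)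
                                                (proj₂ (upToLayer-distinct k))) Bₗ-topped)

T′-refutation : ∀ k → RefutationOfSize (T′ k) (18 * (3 + k) ∸ 29)
T′-refutation k = _ , refutation-ResSeq k , refutation-distinct k , length-refutation k

T′-width3-refutation : ∀ k → WidDeriv 3 (T′ k) []
T′-width3-refutation k = ResSeq⇒WidDeriv (refutation-ResSeq k) (refutation-sizes≤3 k) (here refl)

-- Within a block this is
-- computed on the templates; blocks of one chain have different largest
-- indices; blocks of chain 1 mention y¹, those of chain 2 do not.
Separated : Clause → Clause → Set
Separated d d' = All (λ C → All (Distinct C) (X₀ d')) (X₀ d)

Topped-< : ∀ {m m' C D} → Topped m C → Topped m' D → m < m' → Distinct C D
Topped-< (_ , below) (reaches' , _) m<m' s = Reaches⇒Below⇒¬SetEq reaches' below m<m' (λ z → proj₂ (s z) , proj₁ (s z))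

BlockTopped : ℕ → Clause → Set
BlockTopped m d = All (Topped m) (X₀ d)

BlockTopped-< : ∀ {m m'} d d' → BlockTopped m d → BlockTopped m' d' → m < m' → Separated d d'
BlockTopped-< _ _ t t' m<m' = All.map (λ tC → All.map (λ tD → Topped-< tC tD m<m') t') t

first-topped : ∀ a → BlockTopped 5 (first a)
first-topped a = toWitness {a? = All.all? (topped? 5) (X₀ (first a))} _

middle-topped : ∀ a j → BlockTopped (7 + (j + j)) (shiftC j (middle a))
middle-topped a j = All.map⁺ (All.map (Topped-shift j) (toWitness {a? = All.all? (topped? 7) (X₀ (middle a))} _))

last-topped : ∀ a L k → (L ≡ pos (v 3) ⊎ L ≡ neg (v 3)) → BlockTopped (6 + (k + k)) (shiftC k (last a L))
last-topped a .(pos (v 3)) k (inj₁ refl) =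
  All.map⁺ (All.map (Topped-shift k) (toWitness {a? = All.all? (topped? 6) (X₀ (last a (pos (v 3))))} _))
last-topped a .(neg (v 3)) k (inj₂ refl) =
  All.map⁺ (All.map (Topped-shift k) (toWitness {a? = All.all? (topped? 6) (X₀ (last a (neg (v 3))))} _))

chain-separated : ∀ a L k → (L ≡ pos (v 3) ⊎ L ≡ neg (v 3)) → AllPairs Separated (chain a L k)
chain-separated a L k L≡±v₃ =
  All.++⁺ (All.applyUpTo⁺₂ (λ j → shiftC j (middle a)) k (λ j → BlockTopped-< (first a) (shiftC j (middle a)) (first-topped a) (middle-topped a j) (s≤s (s≤s (s≤s (s≤s (s≤s (s≤s z≤n))))))))
          (BlockTopped-< (first a) (shiftC k (last a L)) (first-topped a) (last-topped a L k L≡±v₃) (s≤s (s≤s (s≤s (s≤s (s≤s (s≤s z≤n)))))) ∷ [])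
  ∷ AllPairs.++⁺ (AllPairs.applyUpTo⁺₁ (λ j → shiftC j (middle a)) k (λ {i} {j} i<j _ → BlockTopped-< (shiftC i (middle a)) (shiftC j (middle a)) (middle-topped a i) (middle-topped a j) (middle<middle i<j)))
                 ([] ∷ [])
                 (All.applyUpTo⁺₁ (λ j → shiftC j (middle a)) k (λ {j} j<k → BlockTopped-< (shiftC j (middle a)) (shiftC k (last a L)) (middle-topped a j) (last-topped a L k L≡±v₃) (middle<last j<k) ∷ []))
  where
  double-< : ∀ {i j} → i < j → suc (i + i) < j + j
  double-< {i} {j} i<j = ≤-trans (s≤s (≤-reflexive (sym (+-suc i i)))) (+-mono-≤ i<j i<j)
  middle<middle : ∀ {i j} → i < j → 7 + (i + i) < 7 + (j + j)
  middle<middle i<j = +-monoʳ-≤ 7 (≤-trans (n≤1+n _) (double-< i<j))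
  middle<last : ∀ {j k} → j < k → 7 + (j + j) < 6 + (k + k)
  middle<last j<k = +-monoʳ-≤ 6 (double-< j<k)

Chain₁ : Var → Set
Chain₁ (v _) = ⊥
Chain₁ (y a _) = a ≡ 1

chain₁? : ∀ x → Dec (Chain₁ x)
chain₁? (v _) = no λ ()
chain₁? (y a _) = a ≟ 1

Chain₁-shift : ∀ j l → Chain₁ (var (shiftL j l)) ≡ Chain₁ (var l)
Chain₁-shift j l rewrite var-shift j l with var l
... | v _ = refl
... | y _ _ = refl

Mentions₁ Avoids₁ : Clause → Set
Mentions₁ C = Any (Chain₁ ∘ var) C
Avoids₁ C = All (¬_ ∘ Chain₁ ∘ var) C

Mentions₁-shift : ∀ j {C} → Mentions₁ C → Mentions₁ (shiftC j C)
Mentions₁-shift j m = Any.map⁺ (Any.map (λ {l} → subst (λ P → P) (sym (Chain₁-shift j l))) m)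

Avoids₁-shift : ∀ j {C} → Avoids₁ C → Avoids₁ (shiftC j C)
Avoids₁-shift j a = All.map⁺ (All.map (λ {l} → subst ¬_ (sym (Chain₁-shift j l))) a)

mentions₁? : ∀ d → Dec (All Mentions₁ (X₀ d))
mentions₁? d = All.all? (Any.any? (chain₁? ∘ var)) (X₀ d)

avoids₁? : ∀ d → Dec (All Avoids₁ (X₀ d))
avoids₁? d = All.all? (All.all? (¬? ∘ chain₁? ∘ var)) (X₀ d)

chain₁-mentions : ∀ k → All (λ d → All Mentions₁ (X₀ d)) (chain 1 (pos (v 3)) k)
chain₁-mentions k =
  toWitness {a? = mentions₁? (first 1)} _ ∷
  All.++⁺ (All.applyUpTo⁺₂ _ k (λ j → All.map⁺ (All.map (Mentions₁-shift j) (toWitness {a? = mentions₁? (middle 1)} _))))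
          (All.map⁺ (All.map (Mentions₁-shift k) (toWitness {a? = mentions₁? (last 1 (pos (v 3)))} _)) ∷ [])

chain₂-avoids : ∀ k → All (λ d → All Avoids₁ (X₀ d)) (chain 2 (neg (v 3)) k)
chain₂-avoids k =
  toWitness {a? = avoids₁? (first 2)} _ ∷
  All.++⁺ (All.applyUpTo⁺₂ _ k (λ j → All.map⁺ (All.map (Avoids₁-shift j) (toWitness {a? = avoids₁? (middle 2)} _))))
          (All.map⁺ (All.map (Avoids₁-shift k) (toWitness {a? = avoids₁? (last 2 (neg (v 3)))} _)) ∷ [])

Mentions₁⇒Avoids₁⇒Distinct : ∀ {C D} → Mentions₁ C → Avoids₁ D → Distinct C D
Mentions₁⇒Avoids₁⇒Distinct m a s with find m
... | z , z∈C , chain₁-z = All.lookup a (proj₁ (s z) z∈C) chain₁-z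

X₀-differ : ∀ d → Dec (AllPairs Differ (X₀ d))
X₀-differ d = AllPairs.allPairs? differ? (X₀ d)

block-distinct : ∀ {k d} → Block k d → AllPairs Distinct (X₀ d)
block-distinct first₁ = AllPairs.map Differ⇒¬SetEq (toWitness {a? = X₀-differ (first 1)} _)
block-distinct first₂ = AllPairs.map Differ⇒¬SetEq (toWitness {a? = X₀-differ (first 2)} _)
block-distinct (middle₁ j _) = shift-distinct j (toWitness {a? = X₀-differ (middle 1)} _)
block-distinct (middle₂ j _) = shift-distinct j (toWitness {a? = X₀-differ (middle 2)} _)
block-distinct {k} last₁ = shift-distinct k (toWitness {a? = X₀-differ (last 1 (pos (v 3)))} _)
block-distinct {k} last₂ = shift-distinct k (toWitness {a? = X₀-differ (last 2 (neg (v 3)))} _)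

T′-distinct : ∀ k → AllPairs Distinct (T′ k)
T′-distinct k = AllPairs.concat⁺ (All.map⁺ (All.map block-distinct (blocks-classified k)))
  (AllPairs.map⁺ (AllPairs.++⁺ (chain-separated 1 (pos (v 3)) k (inj₁ refl)) (chain-separated 2 (neg (v 3)) k (inj₂ refl))
    (All.map (λ m → All.map (λ a → All.map (λ mC → All.map (Mentions₁⇒Avoids₁⇒Distinct mC) a) m) (chain₂-avoids k))
             (chain₁-mentions k))))

-- Counting clauses and literals.  T′ k has no repeated clauses, so
-- c(T′ k) and ℓ(T′ k) are sums over the blocks.
==C-sound : ∀ C D → Tᵇ (C ==C D) → SetEq C D
==C-sound C D t with Equivalence.to T-∧ t
... | C⊆D , D⊆C = λ z → included C D C⊆D z , included D C D⊆C z
  where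
  included : ∀ C D → Tᵇ (all (λ l → any (l ==L_) D) C) → ∀ z → z ∈ C → z ∈ D
  included C D t z z∈C = Any.map (==L-sound z _) (Any.any⁻ (z ==L_) D (All.lookup (All.all⁺ _ C t) z∈C))

Distinct⇒==C-false : ∀ {C D} → Distinct C D → (C ==C D) ≡ false
Distinct⇒==C-false {C} {D} distinct with C ==C D in e
... | true = ⊥-elim (distinct (==C-sound C D (subst Tᵇ (sym e) _)))
... | false = refl

nub-T′ : ∀ k → nub _==C_ (T′ k) ≡ T′ k
nub-T′ k = nub-distinct _==C_ (T′ k) (AllPairs.map Distinct⇒==C-false (T′-distinct k))

blockSum : (Clause → ℕ) → Clause → ℕ
blockSum g d = sum (map g (X₀ d))

sum-map-++ : ∀ (g : Clause → ℕ) Cs Ds → sum (map g (Cs ++ Ds)) ≡ sum (map g Cs) + sum (map g Ds)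
sum-map-++ g Cs Ds = trans (cong sum (map-++ g Cs Ds)) (sum-++ (map g Cs) (map g Ds))

sum-concatMap-X₀ : ∀ (g : Clause → ℕ) ds → sum (map g (concatMap X₀ ds)) ≡ sum (map (blockSum g) ds)
sum-concatMap-X₀ g [] = refl
sum-concatMap-X₀ g (d ∷ ds) = trans (sum-map-++ g (X₀ d) (concatMap X₀ ds)) (cong (blockSum g d +_) (sum-concatMap-X₀ g ds))

ShiftInvariant : (Clause → ℕ) → Set
ShiftInvariant g = ∀ j C → g (shiftC j C) ≡ g C

sum-shift : ∀ {g} → ShiftInvariant g → ∀ j Cs → sum (map g (map (shiftC j) Cs)) ≡ sum (map g Cs)
sum-shift inv j [] = refl
sum-shift inv j (C ∷ Cs) = cong₂ _+_ (inv j C) (sum-shift inv j Cs)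

sum-chain : ∀ {g} → ShiftInvariant g → ∀ a L k → blockSum g (shiftC k (last a L)) ≡ blockSum g (last a L) →
  sum (map (blockSum g) (chain a L k)) ≡ blockSum g (first a) + (k * blockSum g (middle a) + (blockSum g (last a L) + 0))
sum-chain {g} inv a L k last-inv = cong (blockSum g (first a) +_) (trans
  (sum-map-++ (blockSum g) (middles a k) [ shiftC k (last a L) ])
  (cong₂ _+_ (sum-middles k (λ j → j)) (cong (_+ 0) last-inv)))
  where
  sum-middles : ∀ k (f : ℕ → ℕ) → sum (map (blockSum g) (applyUpTo (λ j → shiftC (f j) (middle a)) k)) ≡ k * blockSum g (middle a)
  sum-middles zero f = refl
  sum-middles (suc k) f = cong₂ _+_ (sum-shift inv (f 0) (X₀ (middle a))) (sum-middles k (f ∘ suc))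

sum-T′ : ∀ {g} → ShiftInvariant g → ∀ k →
  sum (map g (T′ k)) ≡ (blockSum g (first 1) + (k * blockSum g (middle 1) + (blockSum g (last 1 (pos (v 3))) + 0)))
                     + (blockSum g (first 2) + (k * blockSum g (middle 2) + (blockSum g (last 2 (neg (v 3))) + 0)))
sum-T′ {g} inv k = begin
  sum (map g (T′ k))                                                                 ≡⟨ sum-concatMap-X₀ g (blocks k) ⟩
  sum (map (blockSum g) (blocks k))                                                  ≡⟨ sum-map-++ (blockSum g) (chain 1 (pos (v 3)) k) (chain 2 (neg (v 3)) k) ⟩
  sum (map (blockSum g) (chain 1 (pos (v 3)) k)) + sum (map (blockSum g) (chain 2 (neg (v 3)) k))
    ≡⟨ cong₂ _+_ (sum-chain inv 1 (pos (v 3)) k (sum-shift inv k (X₀ (last 1 (pos (v 3))))))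
                 (sum-chain inv 2 (neg (v 3)) k (sum-shift inv k (X₀ (last 2 (neg (v 3)))))) ⟩
  _ ∎
  where open ≡-Reasoning

length≡sum-ones : ∀ {A : Set} (xs : List A) → length xs ≡ sum (map (λ _ → 1) xs)
length≡sum-ones [] = refl
length≡sum-ones (_ ∷ xs) = cong suc (length≡sum-ones xs)

-- c(T (3 + k)) = 2 (4 + 4k + 2) = 8 (3 + k) - 12.
T-clauses : ∀ k → cClauses (T (3 + k)) ≡ 8 * (3 + k) ∸ 12
T-clauses k = begin
  length (nub _==C_ (T (3 + k)))  ≡⟨ cong (length ∘ nub _==C_) (T-normal-form k) ⟩
  length (nub _==C_ (T′ k))       ≡⟨ cong length (nub-T′ k) ⟩
  length (T′ k)                   ≡⟨ length≡sum-ones (T′ k) ⟩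
  sum (map (λ _ → 1) (T′ k))      ≡⟨ sum-T′ {λ _ → 1} (λ _ _ → refl) k ⟩
  (4 + (k * 4 + 2)) + (4 + (k * 4 + 2)) ≡⟨ sym (m+n∸m≡n 12 _) ⟩
  12 + ((4 + (k * 4 + 2)) + (4 + (k * 4 + 2))) ∸ 12 ≡⟨ cong (_∸ 12) (arith k) ⟩
  8 * (3 + k) ∸ 12                ∎
  where
  open ≡-Reasoning
  arith : ∀ k → 12 + ((4 + (k * 4 + 2)) + (4 + (k * 4 + 2))) ≡ 8 * (3 + k)
  arith = solve-∀

-- ℓ(T (3 + k)) = 2 (12 + 12k + 4) = 24 (3 + k) - 40.
T-literals : ∀ k → ℓLits (T (3 + k)) ≡ 24 * (3 + k) ∸ 40
T-literals k = begin
  sum (map size (nub _==C_ (T (3 + k))))  ≡⟨ cong (sum ∘ map size ∘ nub _==C_) (T-normal-form k) ⟩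
  sum (map size (nub _==C_ (T′ k)))       ≡⟨ cong (sum ∘ map size) (nub-T′ k) ⟩
  sum (map size (T′ k))                   ≡⟨ sum-T′ size-shift k ⟩
  (12 + (k * 12 + 4)) + (12 + (k * 12 + 4)) ≡⟨ sym (m+n∸m≡n 40 _) ⟩
  40 + ((12 + (k * 12 + 4)) + (12 + (k * 12 + 4))) ∸ 40 ≡⟨ cong (_∸ 40) (arith k) ⟩
  24 * (3 + k) ∸ 40                       ∎
  where
  open ≡-Reasoning
  arith : ∀ k → 40 + ((12 + (k * 12 + 4)) + (12 + (k * 12 + 4))) ≡ 24 * (3 + k)
  arith = solve-∀

original-var : ℕ → Var
original-var i = v (suc i)

aux-var : ℕ → ℕ → Var
aux-var a i = y a (2 + i)

variables : ℕ → List Var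
variables k = applyUpTo original-var (3 + k) ++ (applyUpTo (aux-var 1) (suc k) ++ applyUpTo (aux-var 2) (suc k))

occurring : ℕ → List Var
occurring k = concatMap (map var) (T′ k)

variables-unique : ∀ k → Unique (variables k)
variables-unique k =
  AllPairs.++⁺ (AllPairs.applyUpTo⁺₁ original-var (3 + k) (λ i<j _ e → <⇒≢ i<j (suc-injective (v-injective e))))
    (AllPairs.++⁺ (aux-unique 1) (aux-unique 2)
      (All.applyUpTo⁺₂ (aux-var 1) (suc k) (λ i → All.applyUpTo⁺₂ (aux-var 2) (suc k) (λ j e → 1≢2 (proj₁ (y-injective e))))))
    (All.applyUpTo⁺₂ original-var (3 + k) (λ i → All.++⁺ (All.applyUpTo⁺₂ (aux-var 1) (suc k) (λ j ())) (All.applyUpTo⁺₂ (aux-var 2) (suc k) (λ j ()))))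
  where
  1≢2 : 1 ≢ 2
  1≢2 ()
  aux-unique : ∀ a → Unique (applyUpTo (aux-var a) (suc k))
  aux-unique a = AllPairs.applyUpTo⁺₁ (aux-var a) (suc k) (λ i<j _ e → <⇒≢ i<j (suc-injective (suc-injective (proj₂ (y-injective e)))))

length-variables : ∀ k → length (variables k) ≡ (3 + k) + (suc k + suc k)
length-variables k = trans (length-++ (applyUpTo original-var (3 + k)))
  (cong₂ _+_ (length-applyUpTo original-var (3 + k))
    (trans (length-++ (applyUpTo (aux-var 1) (suc k))) (cong₂ _+_ (length-applyUpTo (aux-var 1) (suc k)) (length-applyUpTo (aux-var 2) (suc k)))))

module _ (k : ℕ) where

  v∈ : ∀ i → i < 3 + k → v (suc i) ∈ variables k
  v∈ i i<n = ∈-++⁺ˡ (∈-applyUpTo⁺ original-var i<n)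

  y¹∈ : ∀ i → i < suc k → y 1 (2 + i) ∈ variables k
  y¹∈ i i≤k = ∈-++⁺ʳ (applyUpTo original-var (3 + k)) (∈-++⁺ˡ (∈-applyUpTo⁺ (aux-var 1) i≤k))

  y²∈ : ∀ i → i < suc k → y 2 (2 + i) ∈ variables k
  y²∈ i i≤k = ∈-++⁺ʳ (applyUpTo original-var (3 + k))
                 (∈-++⁺ʳ (applyUpTo (aux-var 1) (suc k)) (∈-applyUpTo⁺ (aux-var 2) i≤k))

  block-variables : ∀ {d z} → Block k d → z ∈ map var d → z ∈ variables k
  block-variables first₁ (here refl) = v∈ 0 (s≤s z≤n)
  block-variables first₁ (there (here refl)) = v∈ 1 (s≤s (s≤s z≤n))
  block-variables first₁ (there (there (here refl))) = y¹∈ 0 (s≤s z≤n)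
  block-variables first₂ (here refl) = v∈ 0 (s≤s z≤n)
  block-variables first₂ (there (here refl)) = v∈ 1 (s≤s (s≤s z≤n))
  block-variables first₂ (there (there (here refl))) = y²∈ 0 (s≤s z≤n)
  block-variables (middle₁ j j<k) (here refl) = y¹∈ j (≤-trans j<k (n≤1+n k))
  block-variables (middle₁ j j<k) (there (here refl)) = v∈ (2 + j) (s≤s (s≤s (≤-trans j<k (n≤1+n k))))
  block-variables (middle₁ j j<k) (there (there (here refl))) = y¹∈ (suc j) (s≤s j<k)
  block-variables (middle₂ j j<k) (here refl) = y²∈ j (≤-trans j<k (n≤1+n k))
  block-variables (middle₂ j j<k) (there (here refl)) = v∈ (2 + j) (s≤s (s≤s (≤-trans j<k (n≤1+n k))))
  block-variables (middle₂ j j<k) (there (there (here refl))) = y²∈ (suc j) (s≤s j<k)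
  block-variables last₁ (here refl) = y¹∈ k ≤-refl
  block-variables last₁ (there (here refl)) = v∈ (2 + k) ≤-refl
  block-variables last₂ (here refl) = y²∈ k ≤-refl
  block-variables last₂ (there (here refl)) = v∈ (2 + k) ≤-refl

  occurring⊆variables : ∀ {z} → z ∈ occurring k → z ∈ variables k
  occurring⊆variables m with find (∈-concatMap⁻ (map var) {xs = T′ k} m)
  ... | D , D∈T′ , z∈D with find (∈-concatMap⁻ X₀ {xs = blocks k} D∈T′)
  ... | d , d∈blocks , D∈X₀d =
    block-variables (All.lookup (blocks-classified k) d∈blocks) (subst (_ ∈_) (All.lookup (X₀-vars d) D∈X₀d) z∈D)

  -- X₀ of a block is nonempty, so every variable of a block occurs in T′ k.
  X₀-block-nonempty : ∀ {d} → Block k d → Σ Clause (_∈ X₀ d)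
  X₀-block-nonempty first₁ = _ , here refl
  X₀-block-nonempty first₂ = _ , here refl
  X₀-block-nonempty (middle₁ _ _) = _ , here refl
  X₀-block-nonempty (middle₂ _ _) = _ , here refl
  X₀-block-nonempty last₁ = _ , here refl
  X₀-block-nonempty last₂ = _ , here refl

  block-occurring : ∀ {d z} → Block k d → z ∈ map var d → z ∈ occurring k
  block-occurring {d} b z∈d with X₀-block-nonempty b
  ... | D , D∈X₀d = ∈-concatMap⁺ (map var) (Any.map (λ { refl → subst (_ ∈_) (sym (All.lookup (X₀-vars d) D∈X₀d)) z∈d }) (∈T′ b D∈X₀d))

  variables⊆occurring : ∀ {z} → z ∈ variables k → z ∈ occurring k
  variables⊆occurring m with ∈-++⁻ (applyUpTo original-var (3 + k)) m
  ... | inj₁ m-v with ∈-applyUpTo⁻ original-var m-v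
  ...   | zero , _ , refl = block-occurring first₁ (here refl)
  ...   | suc zero , _ , refl = block-occurring first₁ (there (here refl))
  ...   | suc (suc j) , s≤s (s≤s j<1+k) , refl with m<1+n⇒m<n∨m≡n j<1+k
  ...     | inj₁ j<k = block-occurring (middle₁ j j<k) (there (here refl))
  ...     | inj₂ refl = block-occurring last₁ (there (here refl))
  variables⊆occurring m | inj₂ m-y with ∈-++⁻ (applyUpTo (aux-var 1) (suc k)) m-y
  ... | inj₁ m-y¹ with ∈-applyUpTo⁻ (aux-var 1) m-y¹
  ...   | zero , _ , refl = block-occurring first₁ (there (there (here refl)))
  ...   | suc j , s≤s j<k , refl = block-occurring (middle₁ j j<k) (there (there (here refl)))
  variables⊆occurring m | inj₂ m-y | inj₂ m-y² with ∈-applyUpTo⁻ (aux-var 2) m-y²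
  ...   | zero , _ , refl = block-occurring first₂ (there (there (here refl)))
  ...   | suc j , s≤s j<k , refl = block-occurring (middle₂ j j<k) (there (there (here refl)))

-- n(T (3 + k)) = (3 + k) + 2 (1 + k) = 3 (3 + k) - 4.
T-variables : ∀ k → nVars (T (3 + k)) ≡ 3 * (3 + k) ∸ 4
T-variables k = begin
  length (nub _==V_ (concatMap (map var) (T (3 + k))))  ≡⟨ cong (λ F → length (nub _==V_ (concatMap (map var) F))) (T-normal-form k) ⟩
  length (nub _==V_ (occurring k))                      ≡⟨ length-nub _==V_ ==V-sound ==V-refl (occurring k)
                                                             (variables-unique k) (occurring⊆variables k) (variables⊆occurring k) ⟩
  length (variables k)                                  ≡⟨ length-variables k ⟩
  (3 + k) + (suc k + suc k)                             ≡⟨ sym (m+n∸m≡n 4 _) ⟩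
  4 + ((3 + k) + (suc k + suc k)) ∸ 4                   ≡⟨ cong (_∸ 4) (arith k) ⟩
  3 * (3 + k) ∸ 4                                       ∎
  where
  open ≡-Reasoning
  arith : ∀ k → 4 + ((3 + k) + (suc k + suc k)) ≡ 3 * (3 + k)
  arith = solve-∀

T-sizes-small : ∀ n → Dec (All (λ C → size C ≤ 3) (T n))
T-sizes-small n = All.all? (λ C → size C ≤? 3) (T n)

T2-fragment : Σ (List Clause) (Fragment (T 2) [])
T2-fragment = _ , ([]
    +ax (pos x1 ∷ pos x2 ∷ [])
    +ax (pos x1 ∷ neg x2 ∷ [])
    +res resolving (pos x1 ∷ pos x2 ∷ []) (pos x1 ∷ neg x2 ∷ []) (pos x1 ∷ []) (pos x2)
    +ax (neg x1 ∷ pos x2 ∷ [])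
    +ax (neg x1 ∷ neg x2 ∷ [])
    +res resolving (neg x1 ∷ pos x2 ∷ []) (neg x1 ∷ neg x2 ∷ []) (neg x1 ∷ []) (pos x2)
    +res resolving (pos x1 ∷ []) (neg x1 ∷ []) [] (pos x1))
  where
  x1 x2 : Var
  x1 = v 1
  x2 = v 2

T2-refutation : RefutationOfSize (T 2) 7
T2-refutation = _ , append-Fragment [] (λ m → m) (λ ()) (proj₂ T2-fragment) ,
  AllPairs.map Differ⇒¬SetEq (toWitness {a? = AllPairs.allPairs? differ? (proj₁ T2-fragment)} _) , refl

T-unsat : ∀ k → Unsat (T (3 + k))
T-unsat k rewrite T-normal-form k = T′-unsat k

T-sizes≤3 : ∀ k → All (λ C → size C ≤ 3) (T (3 + k))
T-sizes≤3 k rewrite T-normal-form k = T′-size≤3 k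

T-refutation : ∀ k → RefutationOfSize (T (3 + k)) (18 * (3 + k) ∸ 29)
T-refutation k rewrite T-normal-form k = T′-refutation k

T-whd-wid : ∀ k → IsWhd (T (3 + k)) 3 × IsWid (T (3 + k)) 3
T-whd-wid k rewrite T-normal-form k =
  (WidDeriv⇒WhdDeriv (T′-width3-refutation k) , T′-no-narrow-refutation k) ,
  (T′-width3-refutation k , λ j j<3 → T′-no-narrow-refutation k j j<3 ∘ WidDeriv⇒WhdDeriv)

from3 : ∀ {P : ℕ → Set} → (∀ k → P (3 + k)) → ∀ n → 3 ≤ n → P n
from3 P₃₊ (suc (suc (suc k))) _ = P₃₊ k
from3 P₃₊ (suc zero) (s≤s ())
from3 P₃₊ (suc (suc zero)) (s≤s (s≤s ()))

from2 : ∀ {P : ℕ → Set} → P 2 → (∀ k → P (3 + k)) → ∀ n → 2 ≤ n → P n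
from2 P₂ P₃₊ (suc (suc zero)) _ = P₂
from2 P₂ P₃₊ (suc (suc (suc k))) _ = P₃₊ k
from2 P₂ P₃₊ (suc zero) (s≤s ())

from1 : ∀ {P : ℕ → Set} → P 1 → P 2 → (∀ k → P (3 + k)) → ∀ n → 1 ≤ n → P n
from1 P₁ P₂ P₃₊ (suc zero) _ = P₁
from1 {P} P₁ P₂ P₃₊ (suc (suc n)) _ = from2 {P} P₂ P₃₊ (suc (suc n)) (s≤s (s≤s z≤n))

theorem13p6 :
    ((n : ℕ) → 2 ≤ n → nVars (T n) ≡ 3 * n ∸ 4)
    × ((n : ℕ) → 2 ≤ n → cClauses (T n) ≡ 8 * n ∸ 12)
    × ((n : ℕ) → 2 ≤ n → ℓLits (T n) ≡ 24 * n ∸ 40)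
    × ((n : ℕ) → 1 ≤ n → Unsat (T n) × All (λ C → size C ≤ 3) (T n))
    × ((n : ℕ) → 3 ≤ n → IsWhd (T n) 3 × IsWid (T n) 3)
    × ((n : ℕ) → 2 ≤ n → RefutationOfSize (T n) (18 * n ∸ 29))
theorem13p6 =
    from2 refl T-variables
  , from2 refl T-clauses
  , from2 refl T-literals
  , from1 (T1-unsat , toWitness {a? = T-sizes-small 1} _) (T2-unsat , toWitness {a? = T-sizes-small 2} _)
          (λ k → T-unsat k , T-sizes≤3 k)
  , from3 T-whd-wid
  , from2 T2-refutation T-refutation
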